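{- For every positive integer $N$, \[ \sum_{n=1}^{N-1}\frac{a_n^{(N)}}{n}=\sum_{n=1}^{N-1}\frac{N}{n^2+N^2}, \] where \[ a_n^{(N)}\coloneqq\left(\prod_{i=1}^n\frac{N-i}{i^2+N^2}\right)\sum_{0\leq j<n/2}(-1)^{n+j+1}\left[{n+1\atop 2j+2}\right]N^{2j+1}, \] and moreover \[ \lim_{N\to\infty}a_n^{(N)}=\begin{cases}(-1)^{\frac{n-1}{2}} & \text{if } n \text{ is odd},\\ 0 & \text{if } n \text{ is even.}\end{cases} \]
   Context: Here $\left[{n\atop j}\right]$ denotes the unsigned Stirling number of the first kind, defined by $x(x+1)\cdots(x+n-1)=\sum_{j=0}^n\left[{n\atop j}\right]x^j$. -}

module Defs where

open import Data.Nat using (ℕ; zero; suc; _*_; _^_; _<ᵇ_; _∸_; _/_; _%_; _≡ᵇ_)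
import Data.Nat as ℕ
open import Data.Integer using (ℤ; +_)
import Data.Integer as ℤ
open import Data.Rational using (ℚ; 0ℚ; 1ℚ; _+_; -_)
import Data.Rational as ℚ
open import Data.List using (List; []; _∷_)
open import Data.Bool using (if_then_else_)

-- Polynomials with ℕ coefficients as coefficient lists (constant term first).
Poly : Set
Poly = List ℕ

_⊕_ : Poly → Poly → Poly
[] ⊕ q = q
(a ∷ p) ⊕ [] = a ∷ p
(a ∷ p) ⊕ (b ∷ q) = (a ℕ.+ b) ∷ (p ⊕ q)

scale : ℕ → Poly → Poly
scale c [] = []
scale c (a ∷ p) = (c * a) ∷ scale c p

mulXplus : ℕ → Poly → Poly
mulXplus c p = (0 ∷ p) ⊕ scale c p

coeff : Poly → ℕ → ℕ
coeff [] j = 0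
coeff (a ∷ p) zero = a
coeff (a ∷ p) (suc j) = coeff p j

rising : ℕ → Poly
rising zero = 1 ∷ []
rising (suc n) = mulXplus n (rising n)

stirling1 : ℕ → ℕ → ℕ
stirling1 n j = coeff (rising n) j

sgn : ℕ → ℚ
sgn zero = 1ℚ
sgn (suc k) = - sgn k

sumQ : ℕ → (ℕ → ℚ) → ℚ
sumQ zero f = 0ℚ
sumQ (suc m) f = sumQ m f + f m

prodQ : ℕ → (ℕ → ℚ) → ℚ
prodQ zero f = 1ℚ
prodQ (suc m) f = prodQ m f ℚ.* f m

natQ : ℕ → ℚ
natQ m = (+ m) ℚ./ 1

-- a_n^{(N)} = (∏_{i=1}^n (N-i)/(i^2+N^2)) * ∑_{0≤j<n/2} (-1)^{n+j+1} [n+1 2j+2] N^{2j+1}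
-- (index i = suc k with k < n; j ranges over j < n with 2j < n)
a : ℕ → ℕ → ℚ
a n N =
  prodQ n (λ k → ((+ N) ℤ.- (+ suc k)) ℚ./ (suc k * suc k ℕ.+ N * N))
  ℚ.* sumQ n (λ j → if (2 * j) <ᵇ n
                    then sgn (n ℕ.+ j ℕ.+ 1)
                         ℚ.* natQ (stirling1 (n ℕ.+ 1) (2 * j ℕ.+ 2))
                         ℚ.* natQ (N ^ (2 * j ℕ.+ 1))
                    else 0ℚ)

limitValue : ℕ → ℚ
limitValue n = if (n % 2) ≡ᵇ 0 then 0ℚ else sgn ((n ∸ 1) / 2)

module Submission where

-- Put z = iN.  As (k - z)(k + z) = k² + N², each factor (k - N)/(k - z) equals
-- -(N - k)/(k² + N²) · (z + k), so ∏_{k=1}^{n} (k - N)/(k - z) is (-1)ⁿ ∏_{k=1}^{n} (N - k)/(k² + N²)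
-- times (z + 1)⋯(z + n) = Σ_j [n+1, j+1] zʲ, whose imaginary part is Σ_l (-1)ˡ [n+1, 2l+2] N^{2l+1}.
-- Hence a_n^{(N)} = -Im ∏_{k=1}^{n} (k - N)/(k - z), and the sum formula is the imaginary part of
--   Σ_{k=1}^{M} (1/k) ∏_{m=1}^{k} (m - M - 1)/(m - z) = -Σ_{k=1}^{M} 1/(k - z)   (M = N - 1),
-- an identity valid for every z off the positive integers, proved by induction on M from a
-- telescoping sum.  For the limit, each factor (k - N)/(k - z) with k ≤ N has ℓ¹-norm at most 1 and
-- lies within 2k/N of -i, so the product lies within 2n²/N of (-i)ⁿ, and -Im (-i)ⁿ is the
-- claimed limit.

open import Algebra.Bundles using (CommutativeRing)
open import Data.Nat as ℕ using (ℕ; zero; suc)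

module RangeSums {r ℓ} (R : CommutativeRing r ℓ) where
  open CommutativeRing R
  open import Algebra.Properties.AbelianGroup +-abelianGroup using (⁻¹-∙-comm)
  open import Algebra.Properties.CommutativeSemigroup +-commutativeSemigroup
    using () renaming (interchange to +-interchange)
  open import Algebra.Properties.CommutativeSemigroup *-commutativeSemigroup
    using () renaming (interchange to *-interchange)
  open import Algebra.Properties.Group +-group using (ε⁻¹≈ε)
  open import Data.Nat.Properties using (n<1+n; m<n⇒m<1+n)
  open import Function.Base using (_∘_)
  open import Relation.Binary.Reasoning.Setoid setoid

  ∑ : ℕ → (ℕ → Carrier) → Carrier
  ∑ zero    f = 0#
  ∑ (suc n) f = ∑ n f + f n

  ∏ : ℕ → (ℕ → Carrier) → Carrier
  ∏ zero    f = 1#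
  ∏ (suc n) f = ∏ n f * f n

  ∑-cong : ∀ n {f g} → (∀ {k} → k ℕ.< n → f k ≈ g k) → ∑ n f ≈ ∑ n g
  ∑-cong zero    f≈g = refl
  ∑-cong (suc n) f≈g = +-cong (∑-cong n (f≈g ∘ m<n⇒m<1+n)) (f≈g (n<1+n n))

  ∏-cong : ∀ n {f g} → (∀ {k} → k ℕ.< n → f k ≈ g k) → ∏ n f ≈ ∏ n g
  ∏-cong zero    f≈g = refl
  ∏-cong (suc n) f≈g = *-cong (∏-cong n (f≈g ∘ m<n⇒m<1+n)) (f≈g (n<1+n n))

  ∑-zero : ∀ n {f} → (∀ {k} → k ℕ.< n → f k ≈ 0#) → ∑ n f ≈ 0#
  ∑-zero zero    f≈0 = refl
  ∑-zero (suc n) f≈0 =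
    trans (+-cong (∑-zero n (f≈0 ∘ m<n⇒m<1+n)) (f≈0 (n<1+n n))) (+-identityˡ 0#)

  ∑-+ : ∀ n (f g : ℕ → Carrier) → ∑ n (λ k → f k + g k) ≈ ∑ n f + ∑ n g
  ∑-+ zero    f g = sym (+-identityˡ 0#)
  ∑-+ (suc n) f g =
    trans (+-congʳ (∑-+ n f g)) (+-interchange (∑ n f) (∑ n g) (f n) (g n))

  ∑-neg : ∀ n (f : ℕ → Carrier) → ∑ n (λ k → - f k) ≈ - ∑ n f
  ∑-neg zero    f = sym ε⁻¹≈ε
  ∑-neg (suc n) f = trans (+-congʳ (∑-neg n f)) (⁻¹-∙-comm (∑ n f) (f n))

  ∑-*ˡ : ∀ n x (f : ℕ → Carrier) → ∑ n (λ k → x * f k) ≈ x * ∑ n f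
  ∑-*ˡ zero    x f = sym (zeroʳ x)
  ∑-*ˡ (suc n) x f = trans (+-congʳ (∑-*ˡ n x f)) (sym (distribˡ x (∑ n f) (f n)))

  ∑-shift : ∀ n (f : ℕ → Carrier) → ∑ (suc n) f ≈ f 0 + ∑ n (f ∘ suc)
  ∑-shift zero    f = +-comm 0# (f 0)
  ∑-shift (suc n) f =
    trans (+-congʳ (∑-shift n f)) (+-assoc (f 0) (∑ n (f ∘ suc)) (f (suc n)))

  ∑-telescope : ∀ n (f : ℕ → Carrier) → ∑ n (λ k → f k - f (suc k)) ≈ f 0 - f n
  ∑-telescope zero    f = sym (-‿inverseʳ (f 0))
  ∑-telescope (suc n) f = begin
    ∑ n (λ k → f k - f (suc k)) + (f n - f (suc n))
      ≈⟨ +-congʳ (∑-telescope n f) ⟩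
    (f 0 - f n) + (f n - f (suc n))
      ≈⟨ +-assoc (f 0) (- f n) (f n - f (suc n)) ⟩
    f 0 + (- f n + (f n - f (suc n)))
      ≈⟨ +-congˡ (+-assoc (- f n) (f n) (- f (suc n))) ⟨
    f 0 + ((- f n + f n) - f (suc n))
      ≈⟨ +-congˡ (+-congʳ (-‿inverseˡ (f n))) ⟩
    f 0 + (0# - f (suc n))
      ≈⟨ +-congˡ (+-identityˡ (- f (suc n))) ⟩
    f 0 - f (suc n) ∎

  ∏-* : ∀ n (f g : ℕ → Carrier) → ∏ n (λ k → f k * g k) ≈ ∏ n f * ∏ n g
  ∏-* zero    f g = sym (*-identityˡ 1#)
  ∏-* (suc n) f g =
    trans (*-congʳ (∏-* n f g)) (*-interchange (∏ n f) (∏ n g) (f n) (g n))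

  ∏-shift : ∀ n (f : ℕ → Carrier) → ∏ (suc n) f ≈ f 0 * ∏ n (f ∘ suc)
  ∏-shift zero    f = *-comm 1# (f 0)
  ∏-shift (suc n) f =
    trans (*-congʳ (∏-shift n f)) (*-assoc (f 0) (∏ n (f ∘ suc)) (f (suc n)))

module ShiftedRising where
  open import Data.List.Base using ([]; _∷_; length)
  import Data.Nat.Properties as ℕ
  open import Defs using (Poly; _⊕_; scale; mulXplus; coeff; rising)
  open import Relation.Binary.PropositionalEquality

  shiftedRising : ℕ → Poly
  shiftedRising zero    = 1 ∷ []
  shiftedRising (suc n) = mulXplus (suc n) (shiftedRising n)

  mulXplus-0∷ : ∀ c p → mulXplus c (0 ∷ p) ≡ 0 ∷ mulXplus c p
  mulXplus-0∷ c p = cong (_∷ mulXplus c p) (ℕ.*-zeroʳ c)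

  rising-suc : ∀ n → rising (suc n) ≡ 0 ∷ shiftedRising n
  rising-suc zero    = refl
  rising-suc (suc n) = trans (cong (mulXplus (suc n)) (rising-suc n))
                             (mulXplus-0∷ (suc n) (shiftedRising n))

  length-∷⊕scale : ∀ a c p → length ((a ∷ p) ⊕ scale c p) ≡ suc (length p)
  length-∷⊕scale a c []      = refl
  length-∷⊕scale a c (b ∷ p) = cong suc (length-∷⊕scale b c p)

  length-shiftedRising : ∀ n → length (shiftedRising n) ≡ suc n
  length-shiftedRising zero    = refl
  length-shiftedRising (suc n) =
    trans (length-∷⊕scale 0 (suc n) (shiftedRising n)) (cong suc (length-shiftedRising n))

  coeff-beyond-length : ∀ p {k} → length p ℕ.≤ k → coeff p k ≡ 0
  coeff-beyond-length []      _                   = refl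
  coeff-beyond-length (a ∷ p) {suc k} (ℕ.s≤s len≤k) = coeff-beyond-length p len≤k

module PolynomialEvaluation {r ℓ} (R : CommutativeRing r ℓ) where
  open CommutativeRing R
  open import Algebra.Properties.CommutativeSemigroup +-commutativeSemigroup
    using () renaming (interchange to +-interchange)
  open import Algebra.Properties.CommutativeSemigroup *-commutativeSemigroup
    using (x∙yz≈y∙xz)
  open import Algebra.Properties.Semiring.Mult semiring using (_×_; ×-homo-+; ×1-homo-*)
  open import Data.List.Base using ([]; _∷_)
  open import Defs using (Poly; _⊕_; scale; mulXplus)
  open import Relation.Binary.Reasoning.Setoid setoid
  open RangeSums R using (∏)
  open ShiftedRising using (shiftedRising)

  eval : Poly → Carrier → Carrier
  eval []      x = 0#
  eval (a ∷ p) x = a × 1# + x * eval p x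

  eval-⊕ : ∀ p q x → eval (p ⊕ q) x ≈ eval p x + eval q x
  eval-⊕ []      q       x = sym (+-identityˡ (eval q x))
  eval-⊕ (a ∷ p) []      x = sym (+-identityʳ (eval (a ∷ p) x))
  eval-⊕ (a ∷ p) (b ∷ q) x = begin
    (a ℕ.+ b) × 1# + x * eval (p ⊕ q) x
      ≈⟨ +-cong (×-homo-+ 1# a b) (*-congˡ (eval-⊕ p q x)) ⟩
    (a × 1# + b × 1#) + x * (eval p x + eval q x)
      ≈⟨ +-congˡ (distribˡ x (eval p x) (eval q x)) ⟩
    (a × 1# + b × 1#) + (x * eval p x + x * eval q x)
      ≈⟨ +-interchange (a × 1#) (b × 1#) (x * eval p x) (x * eval q x) ⟩
    (a × 1# + x * eval p x) + (b × 1# + x * eval q x) ∎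

  eval-scale : ∀ c p x → eval (scale c p) x ≈ c × 1# * eval p x
  eval-scale c []      x = sym (zeroʳ (c × 1#))
  eval-scale c (a ∷ p) x = begin
    (c ℕ.* a) × 1# + x * eval (scale c p) x
      ≈⟨ +-cong (×1-homo-* c a) (*-congˡ (eval-scale c p x)) ⟩
    c × 1# * a × 1# + x * (c × 1# * eval p x)
      ≈⟨ +-congˡ (x∙yz≈y∙xz x (c × 1#) (eval p x)) ⟩
    c × 1# * a × 1# + c × 1# * (x * eval p x)
      ≈⟨ distribˡ (c × 1#) (a × 1#) (x * eval p x) ⟨
    c × 1# * (a × 1# + x * eval p x) ∎

  eval-mulXplus : ∀ c p x → eval (mulXplus c p) x ≈ (x + c × 1#) * eval p x
  eval-mulXplus c p x = begin
    eval ((0 ∷ p) ⊕ scale c p) x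
      ≈⟨ eval-⊕ (0 ∷ p) (scale c p) x ⟩
    (0# + x * eval p x) + eval (scale c p) x
      ≈⟨ +-cong (+-identityˡ (x * eval p x)) (eval-scale c p x) ⟩
    x * eval p x + c × 1# * eval p x
      ≈⟨ distribʳ (eval p x) x (c × 1#) ⟨
    (x + c × 1#) * eval p x ∎

  eval-shiftedRising : ∀ n x → eval (shiftedRising n) x ≈ ∏ n (λ m → x + suc m × 1#)
  eval-shiftedRising zero    x = begin
    (1# + 0#) + x * 0#  ≈⟨ +-cong (+-identityʳ 1#) (zeroʳ x) ⟩
    1# + 0#             ≈⟨ +-identityʳ 1# ⟩
    1#                  ∎
  eval-shiftedRising (suc n) x = begin
    eval (mulXplus (suc n) (shiftedRising n)) x
      ≈⟨ eval-mulXplus (suc n) (shiftedRising n) x ⟩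
    (x + suc n × 1#) * eval (shiftedRising n) x
      ≈⟨ *-congˡ (eval-shiftedRising n x) ⟩
    (x + suc n × 1#) * ∏ n (λ m → x + suc m × 1#)
      ≈⟨ *-comm (x + suc n × 1#) (∏ n (λ m → x + suc m × 1#)) ⟩
    ∏ (suc n) (λ m → x + suc m × 1#) ∎

module RationalArithmetic where
  open import Data.Empty using (⊥-elim)
  open import Data.Integer.Base as ℤ using (ℤ; +_)
  import Data.Integer.Properties as ℤ
  open import Data.Integer.Tactic.RingSolver using () renaming (solve-∀ to ℤ-solve-∀)
  import Data.Nat.Properties as ℕ
  open import Data.Product.Base using (_,_; ∃-syntax)
  open import Data.Rational.Base
    using (ℚ; mkℚ; 0ℚ; 1ℚ; _+_; _*_; -_; _/_; _≤_; _<_; *<*; ∣_∣; ↧ₙ_; toℚᵘ; nonNegative)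
  import Data.Rational.Properties as ℚ
  open import Data.Rational.Unnormalised.Base as ℚᵘ using (mkℚᵘ; *≡*; *≤*)
  import Data.Rational.Unnormalised.Properties as ℚᵘ
  open import Defs using (natQ; sgn; sumQ; prodQ)
  open import Level using (0ℓ)
  open import Relation.Binary.PropositionalEquality
  open import Relation.Nullary.Decidable.Core using (dec⇒maybe)
  open import Tactic.RingSolver using (solve-∀)
  open import Tactic.RingSolver.Core.AlmostCommutativeRing
    using (AlmostCommutativeRing; fromCommutativeRing)

  -- The solver needs a genuine zero test to normalise constant coefficients such as 1ℚ * 1ℚ.
  ℚ-acr : AlmostCommutativeRing 0ℓ 0ℓ
  ℚ-acr = fromCommutativeRing ℚ.+-*-commutativeRing (λ x → dec⇒maybe (0ℚ ℚ.≟ x))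

  fromℤ : ℤ → ℚ
  fromℤ i = i / 1

  -- i / suc n is by definition fromℚᵘ (mkℚᵘ i n).
  toℚᵘ-/ : ∀ i n → toℚᵘ (i / suc n) ℚᵘ.≃ mkℚᵘ i n
  toℚᵘ-/ i n = ℚ.toℚᵘ-fromℚᵘ (mkℚᵘ i n)

  fromℤ-+ : ∀ i j → fromℤ (i ℤ.+ j) ≡ fromℤ i + fromℤ j
  fromℤ-+ i j = ℚ.toℚᵘ-injective (begin
    toℚᵘ (fromℤ (i ℤ.+ j))              ≈⟨ toℚᵘ-/ (i ℤ.+ j) 0 ⟩
    mkℚᵘ (i ℤ.+ j) 0                    ≈⟨ *≡* (ℤ-identity i j) ⟩
    mkℚᵘ i 0 ℚᵘ.+ mkℚᵘ j 0              ≈⟨ ℚᵘ.+-cong (toℚᵘ-/ i 0) (toℚᵘ-/ j 0) ⟨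
    toℚᵘ (fromℤ i) ℚᵘ.+ toℚᵘ (fromℤ j)  ≈⟨ ℚ.toℚᵘ-homo-+ (fromℤ i) (fromℤ j) ⟨
    toℚᵘ (fromℤ i + fromℤ j)            ∎)
    where
    open ℚᵘ.≃-Reasoning
    ℤ-identity : ∀ i j → (i ℤ.+ j) ℤ.* + 1 ≡ (i ℤ.* + 1 ℤ.+ j ℤ.* + 1) ℤ.* + 1
    ℤ-identity = ℤ-solve-∀

  fromℤ-* : ∀ i j → fromℤ (i ℤ.* j) ≡ fromℤ i * fromℤ j
  fromℤ-* i j = ℚ.toℚᵘ-injective (begin
    toℚᵘ (fromℤ (i ℤ.* j))              ≈⟨ toℚᵘ-/ (i ℤ.* j) 0 ⟩
    mkℚᵘ (i ℤ.* j) 0                    ≈⟨ ℚᵘ.*-cong (toℚᵘ-/ i 0) (toℚᵘ-/ j 0) ⟨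
    toℚᵘ (fromℤ i) ℚᵘ.* toℚᵘ (fromℤ j)  ≈⟨ ℚ.toℚᵘ-homo-* (fromℤ i) (fromℤ j) ⟨
    toℚᵘ (fromℤ i * fromℤ j)            ∎)
    where open ℚᵘ.≃-Reasoning

  fromℤ-neg : ∀ i → fromℤ (ℤ.- i) ≡ - fromℤ i
  fromℤ-neg i = ℚ.toℚᵘ-injective (begin
    toℚᵘ (fromℤ (ℤ.- i))    ≈⟨ toℚᵘ-/ (ℤ.- i) 0 ⟩
    ℚᵘ.- mkℚᵘ i 0           ≈⟨ ℚᵘ.-‿cong (toℚᵘ-/ i 0) ⟨
    ℚᵘ.- toℚᵘ (fromℤ i)     ≈⟨ ℚ.toℚᵘ-homo‿- (fromℤ i) ⟨
    toℚᵘ (- fromℤ i)        ∎)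
    where open ℚᵘ.≃-Reasoning

  natQ-+ : ∀ m n → natQ (m ℕ.+ n) ≡ natQ m + natQ n
  natQ-+ m n = fromℤ-+ (+ m) (+ n)

  natQ-* : ∀ m n → natQ (m ℕ.* n) ≡ natQ m * natQ n
  natQ-* m n = trans (cong fromℤ (ℤ.pos-* m n)) (fromℤ-* (+ m) (+ n))

  /≡fromℤ*1/ : ∀ i n .{{_ : ℕ.NonZero n}} → i / n ≡ fromℤ i * (+ 1 / n)
  /≡fromℤ*1/ i (suc n) = ℚ.toℚᵘ-injective (begin
    toℚᵘ (i / suc n)
      ≈⟨ toℚᵘ-/ i n ⟩
    mkℚᵘ i n
      ≈⟨ *≡* (trans (cong (λ k → i ℤ.* + suc k) (ℕ.+-identityʳ n)) (ℤ-identity i (+ suc n))) ⟩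
    mkℚᵘ i 0 ℚᵘ.* mkℚᵘ (+ 1) n
      ≈⟨ ℚᵘ.*-cong (toℚᵘ-/ i 0) (toℚᵘ-/ (+ 1) n) ⟨
    toℚᵘ (fromℤ i) ℚᵘ.* toℚᵘ (+ 1 / suc n)
      ≈⟨ ℚ.toℚᵘ-homo-* (fromℤ i) (+ 1 / suc n) ⟨
    toℚᵘ (fromℤ i * (+ 1 / suc n)) ∎)
    where
    open ℚᵘ.≃-Reasoning
    ℤ-identity : ∀ i d → i ℤ.* d ≡ (i ℤ.* + 1) ℤ.* d
    ℤ-identity = ℤ-solve-∀

  natQ*1/≡1 : ∀ n .{{_ : ℕ.NonZero n}} → natQ n * (+ 1 / n) ≡ 1ℚ
  natQ*1/≡1 (suc n) = ℚ.toℚᵘ-injective (begin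
    toℚᵘ (natQ (suc n) * (+ 1 / suc n))
      ≈⟨ ℚ.toℚᵘ-homo-* (natQ (suc n)) (+ 1 / suc n) ⟩
    toℚᵘ (natQ (suc n)) ℚᵘ.* toℚᵘ (+ 1 / suc n)
      ≈⟨ ℚᵘ.*-cong (toℚᵘ-/ (+ suc n) 0) (toℚᵘ-/ (+ 1) n) ⟩
    mkℚᵘ (+ suc n) 0 ℚᵘ.* mkℚᵘ (+ 1) n
      ≈⟨ *≡* (trans (ℤ-identity (+ suc n)) (cong (λ k → + 1 ℤ.* + suc k) (sym (ℕ.+-identityʳ n)))) ⟩
    ℚᵘ.1ℚᵘ ∎)
    where
    open ℚᵘ.≃-Reasoning
    ℤ-identity : ∀ d → (d ℤ.* + 1) ℤ.* + 1 ≡ + 1 ℤ.* d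
    ℤ-identity = ℤ-solve-∀

  /≤/ : ∀ a b d e .{{_ : ℕ.NonZero d}} .{{_ : ℕ.NonZero e}} →
        a ℕ.* e ℕ.≤ b ℕ.* d → + a / d ≤ + b / e
  /≤/ a b (suc d) (suc e) ae≤bd = ℚ.toℚᵘ-cancel-≤
    (ℚᵘ.≤-respˡ-≃ (ℚᵘ.≃-sym (toℚᵘ-/ (+ a) d)) (ℚᵘ.≤-respʳ-≃ (ℚᵘ.≃-sym (toℚᵘ-/ (+ b) e))
      (*≤* (subst₂ ℤ._≤_ (ℤ.pos-* a (suc e)) (ℤ.pos-* b (suc d)) (ℤ.+≤+ ae≤bd)))))

  /</ : ∀ a b d e .{{_ : ℕ.NonZero d}} .{{_ : ℕ.NonZero e}} →
        a ℕ.* e ℕ.< b ℕ.* d → + a / d < + b / e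
  /</ a b (suc d) (suc e) ae<bd = ℚ.toℚᵘ-cancel-<
    (ℚᵘ.<-respˡ-≃ (ℚᵘ.≃-sym (toℚᵘ-/ (+ a) d)) (ℚᵘ.<-respʳ-≃ (ℚᵘ.≃-sym (toℚᵘ-/ (+ b) e))
      (ℚᵘ.*<* (subst₂ ℤ._<_ (ℤ.pos-* a (suc e)) (ℤ.pos-* b (suc d)) (ℤ.+<+ ae<bd)))))

  *-mono-≤-nonNeg : ∀ {a b c d} → 0ℚ ≤ a → 0ℚ ≤ c → a ≤ b → c ≤ d → a * c ≤ b * d
  *-mono-≤-nonNeg {a} {b} {c} {d} 0≤a 0≤c a≤b c≤d = ℚ.≤-trans
    (ℚ.*-monoʳ-≤-nonNeg c {{nonNegative 0≤c}} a≤b)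
    (ℚ.*-monoˡ-≤-nonNeg b {{nonNegative (ℚ.≤-trans 0≤a a≤b)}} c≤d)

  +/+≡ : ∀ x y n .{{_ : ℕ.NonZero n}} → + x / n + + y / n ≡ + (x ℕ.+ y) / n
  +/+≡ x y n = begin
    + x / n + + y / n
      ≡⟨ cong₂ _+_ (/≡fromℤ*1/ (+ x) n) (/≡fromℤ*1/ (+ y) n) ⟩
    natQ x * (+ 1 / n) + natQ y * (+ 1 / n)
      ≡⟨ ℚ.*-distribʳ-+ (+ 1 / n) (natQ x) (natQ y) ⟨
    (natQ x + natQ y) * (+ 1 / n)
      ≡⟨ cong (_* (+ 1 / n)) (natQ-+ x y) ⟨
    natQ (x ℕ.+ y) * (+ 1 / n)
      ≡⟨ /≡fromℤ*1/ (+ (x ℕ.+ y)) n ⟨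
    + (x ℕ.+ y) / n ∎
    where open ≡-Reasoning

  ∣+/∣≡ : ∀ x n .{{_ : ℕ.NonZero n}} → ∣ + x / n ∣ ≡ + x / n
  ∣+/∣≡ x n = ℚ.0≤p⇒∣p∣≡p (/≤/ 0 x 1 n ℕ.z≤n)

  ∣-+/∣≡ : ∀ x n .{{_ : ℕ.NonZero n}} → ∣ - (+ x / n) ∣ ≡ + x / n
  ∣-+/∣≡ x n = trans (ℚ.∣-p∣≡∣p∣ (+ x / n)) (∣+/∣≡ x n)

  natQ*+/≡ : ∀ m x n .{{_ : ℕ.NonZero n}} → natQ m * (+ x / n) ≡ + (m ℕ.* x) / n
  natQ*+/≡ m x n = begin
    natQ m * (+ x / n)                ≡⟨ cong (natQ m *_) (/≡fromℤ*1/ (+ x) n) ⟩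
    natQ m * (natQ x * (+ 1 / n))     ≡⟨ ℚ.*-assoc (natQ m) (natQ x) (+ 1 / n) ⟨
    natQ m * natQ x * (+ 1 / n)       ≡⟨ cong (_* (+ 1 / n)) (natQ-* m x) ⟨
    natQ (m ℕ.* x) * (+ 1 / n)        ≡⟨ /≡fromℤ*1/ (+ (m ℕ.* x)) n ⟨
    + (m ℕ.* x) / n                   ∎
    where open ≡-Reasoning

  1/↧p≤p : ∀ p → 0ℚ < p → + 1 / ↧ₙ p ≤ p
  1/↧p≤p (mkℚ (+ 0)       _   _) (*<* 0<0) = ⊥-elim (ℤ.<-irrefl refl 0<0)
  1/↧p≤p (mkℚ ℤ.-[1+ _ ]  _   _) (*<* ())
  1/↧p≤p p@(mkℚ ℤ.+[1+ n ] d-1 _) _ = ℚ.≤-trans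
    (/≤/ 1 (suc n) (suc d-1) (suc d-1) (ℕ.*-monoˡ-≤ (suc d-1) (ℕ.s≤s (ℕ.z≤n {n}))))
    (ℚ.≤-reflexive (ℚ.↥p/↧p≡p p))

  +c/N<ε : ∀ c {ε} → 0ℚ < ε → ∃[ M ] (∀ N .{{_ : ℕ.NonZero N}} → M ℕ.≤ N → + c / N < ε)
  +c/N<ε c {ε} 0<ε = suc (c ℕ.* ↧ₙ ε) , λ N 1+c*↧ε≤N →
    ℚ.<-≤-trans (/</ c 1 N (↧ₙ ε) (subst (c ℕ.* ↧ₙ ε ℕ.<_) (sym (ℕ.*-identityˡ N)) 1+c*↧ε≤N))
                (1/↧p≤p ε 0<ε)

  module Σℚ = RangeSums ℚ.+-*-commutativeRing

  sumQ≡∑ : ∀ n f → sumQ n f ≡ Σℚ.∑ n f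
  sumQ≡∑ zero    f = refl
  sumQ≡∑ (suc n) f = cong (_+ f n) (sumQ≡∑ n f)

  prodQ≡∏ : ∀ n f → prodQ n f ≡ Σℚ.∏ n f
  prodQ≡∏ zero    f = refl
  prodQ≡∏ (suc n) f = cong (_* f n) (prodQ≡∏ n f)

  sgn-+ : ∀ m n → sgn (m ℕ.+ n) ≡ sgn m * sgn n
  sgn-+ zero    n = sym (ℚ.*-identityˡ (sgn n))
  sgn-+ (suc m) n = trans (cong -_ (sgn-+ m n)) (ℚ.neg-distribˡ-* (sgn m) (sgn n))

  ∏-neg : ∀ n f → Σℚ.∏ n (λ k → - f k) ≡ sgn n * Σℚ.∏ n f
  ∏-neg zero    f = sym (ℚ.*-identityˡ 1ℚ)
  ∏-neg (suc n) f =
    trans (cong (_* - f n) (∏-neg n f)) (regroup (sgn n) (Σℚ.∏ n f) (f n))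
    where
    regroup : ∀ s p x → s * p * - x ≡ - s * (p * x)
    regroup = solve-∀ ℚ-acr

module GaussianRationals where
  open import Algebra.Consequences.Propositional using (comm∧idˡ⇒idʳ; comm∧distrˡ⇒distrʳ)
  open import Algebra.Structures using (IsCommutativeRing)
  open import Data.Maybe.Base using (Maybe; just; nothing)
  open import Data.Product.Base using (_,_)
  open import Data.Rational.Base using (ℚ; 0ℚ; 1ℚ; _+_; _*_; -_; _-_)
  import Data.Rational.Properties as ℚ
  open import Defs using (natQ)
  open import Level using (0ℓ)
  open import Relation.Binary.PropositionalEquality
  open import Relation.Nullary.Decidable.Core using (yes)
  open import Tactic.RingSolver using (solve-∀)
  open import Tactic.RingSolver.Core.AlmostCommutativeRing
    using (AlmostCommutativeRing; fromCommutativeRing)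
  open RationalArithmetic using (ℚ-acr; natQ-+; module Σℚ)

  infix  5 _+i_
  infixl 6 _+ᵢ_ _-ᵢ_
  infixl 7 _*ᵢ_
  infix  8 -ᵢ_

  record ℚ[i] : Set where
    constructor _+i_
    field
      re im : ℚ

  open ℚ[i] public

  _+ᵢ_ : ℚ[i] → ℚ[i] → ℚ[i]
  x +ᵢ y = (re x + re y) +i (im x + im y)

  _*ᵢ_ : ℚ[i] → ℚ[i] → ℚ[i]
  x *ᵢ y = (re x * re y - im x * im y) +i (re x * im y + im x * re y)

  -ᵢ_ : ℚ[i] → ℚ[i]
  -ᵢ x = (- re x) +i (- im x)

  _-ᵢ_ : ℚ[i] → ℚ[i] → ℚ[i]
  x -ᵢ y = x +ᵢ -ᵢ y

  0ᵢ 1ᵢ -i : ℚ[i]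
  0ᵢ = 0ℚ +i 0ℚ
  1ᵢ = 1ℚ +i 0ℚ
  -i = 0ℚ +i - 1ℚ

  ofℚ : ℚ → ℚ[i]
  ofℚ x = x +i 0ℚ

  ℚ[i]-ext : ∀ {x y} → re x ≡ re y → im x ≡ im y → x ≡ y
  ℚ[i]-ext refl refl = refl

  private
    *-assoc-re : ∀ a b c d e f →
      (a * c - b * d) * e - (a * d + b * c) * f ≡ a * (c * e - d * f) - b * (c * f + d * e)
    *-assoc-re = solve-∀ ℚ-acr
    *-assoc-im : ∀ a b c d e f →
      (a * c - b * d) * f + (a * d + b * c) * e ≡ a * (c * f + d * e) + b * (c * e - d * f)
    *-assoc-im = solve-∀ ℚ-acr
    *-comm-re : ∀ a b c d → a * c - b * d ≡ c * a - d * b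
    *-comm-re = solve-∀ ℚ-acr
    *-comm-im : ∀ a b c d → a * d + b * c ≡ c * b + d * a
    *-comm-im = solve-∀ ℚ-acr
    *-identityˡ-re : ∀ a b → 1ℚ * a - 0ℚ * b ≡ a
    *-identityˡ-re = solve-∀ ℚ-acr
    *-identityˡ-im : ∀ a b → 1ℚ * b + 0ℚ * a ≡ b
    *-identityˡ-im = solve-∀ ℚ-acr
    distribˡ-re : ∀ a b c d e f →
      a * (c + e) - b * (d + f) ≡ (a * c - b * d) + (a * e - b * f)
    distribˡ-re = solve-∀ ℚ-acr
    distribˡ-im : ∀ a b c d e f →
      a * (d + f) + b * (c + e) ≡ (a * d + b * c) + (a * f + b * e)
    distribˡ-im = solve-∀ ℚ-acr

  ℚ[i]-isCommutativeRing : IsCommutativeRing _≡_ _+ᵢ_ _*ᵢ_ -ᵢ_ 0ᵢ 1ᵢ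
  ℚ[i]-isCommutativeRing = record
    { isRing = record
      { +-isAbelianGroup = record
        { isGroup = record
          { isMonoid = record
            { isSemigroup = record
              { isMagma = record { isEquivalence = isEquivalence ; ∙-cong = cong₂ _+ᵢ_ }
              ; assoc   = λ x y z →
                  ℚ[i]-ext (ℚ.+-assoc (re x) (re y) (re z)) (ℚ.+-assoc (im x) (im y) (im z))
              }
            ; identity = (λ x → ℚ[i]-ext (ℚ.+-identityˡ (re x)) (ℚ.+-identityˡ (im x)))
                       , (λ x → ℚ[i]-ext (ℚ.+-identityʳ (re x)) (ℚ.+-identityʳ (im x)))
            }
          ; inverse = (λ x → ℚ[i]-ext (ℚ.+-inverseˡ (re x)) (ℚ.+-inverseˡ (im x)))
                    , (λ x → ℚ[i]-ext (ℚ.+-inverseʳ (re x)) (ℚ.+-inverseʳ (im x)))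
          ; ⁻¹-cong = cong (-ᵢ_)
          }
        ; comm = λ x y → ℚ[i]-ext (ℚ.+-comm (re x) (re y)) (ℚ.+-comm (im x) (im y))
        }
      ; *-cong     = cong₂ _*ᵢ_
      ; *-assoc    = λ x y z →
          ℚ[i]-ext (*-assoc-re (re x) (im x) (re y) (im y) (re z) (im z))
                   (*-assoc-im (re x) (im x) (re y) (im y) (re z) (im z))
      ; *-identity = *-identityˡ , comm∧idˡ⇒idʳ *-comm *-identityˡ
      ; distrib    = distribˡ , comm∧distrˡ⇒distrʳ *-comm distribˡ
      }
    ; *-comm = *-comm
    }
    where
    *-comm : ∀ x y → x *ᵢ y ≡ y *ᵢ x
    *-comm x y = ℚ[i]-ext (*-comm-re (re x) (im x) (re y) (im y))
                          (*-comm-im (re x) (im x) (re y) (im y))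
    *-identityˡ : ∀ x → 1ᵢ *ᵢ x ≡ x
    *-identityˡ x = ℚ[i]-ext (*-identityˡ-re (re x) (im x)) (*-identityˡ-im (re x) (im x))
    distribˡ : ∀ x y z → x *ᵢ (y +ᵢ z) ≡ x *ᵢ y +ᵢ x *ᵢ z
    distribˡ x y z = ℚ[i]-ext (distribˡ-re (re x) (im x) (re y) (im y) (re z) (im z))
                              (distribˡ-im (re x) (im x) (re y) (im y) (re z) (im z))

  ℚ[i]-commutativeRing : CommutativeRing 0ℓ 0ℓ
  ℚ[i]-commutativeRing = record { isCommutativeRing = ℚ[i]-isCommutativeRing }

  ℚ[i]-acr : AlmostCommutativeRing 0ℓ 0ℓ
  ℚ[i]-acr = fromCommutativeRing ℚ[i]-commutativeRing is-0ᵢ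
    where
    is-0ᵢ : ∀ x → Maybe (0ᵢ ≡ x)
    is-0ᵢ x with 0ℚ ℚ.≟ re x | 0ℚ ℚ.≟ im x
    ... | yes 0≡re | yes 0≡im = just (ℚ[i]-ext 0≡re 0≡im)
    ... | _        | _        = nothing

  module Σᵢ = RangeSums ℚ[i]-commutativeRing

  open import Algebra.Definitions.RawMonoid (CommutativeRing.+-rawMonoid ℚ[i]-commutativeRing)
    public using (_×_)

  n×1ᵢ≡n+0i : ∀ n → n × 1ᵢ ≡ natQ n +i 0ℚ
  n×1ᵢ≡n+0i zero    = refl
  n×1ᵢ≡n+0i (suc n) =
    trans (cong (1ᵢ +ᵢ_) (n×1ᵢ≡n+0i n)) (ℚ[i]-ext (sym (natQ-+ 1 n)) refl)

  ofℚ-* : ∀ x y → ofℚ x *ᵢ ofℚ y ≡ ofℚ (x * y)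
  ofℚ-* x y = ℚ[i]-ext (re-identity x y) (im-identity x y)
    where
    re-identity : ∀ x y → x * y - 0ℚ * 0ℚ ≡ x * y
    re-identity = solve-∀ ℚ-acr
    im-identity : ∀ x y → x * 0ℚ + 0ℚ * y ≡ 0ℚ
    im-identity = solve-∀ ℚ-acr

  ∏-ofℚ : ∀ n f → Σᵢ.∏ n (λ k → ofℚ (f k)) ≡ ofℚ (Σℚ.∏ n f)
  ∏-ofℚ zero    f = refl
  ∏-ofℚ (suc n) f =
    trans (cong (_*ᵢ ofℚ (f n)) (∏-ofℚ n f)) (ofℚ-* (Σℚ.∏ n f) (f n))

  im-ofℚ* : ∀ x y → im (ofℚ x *ᵢ y) ≡ x * im y
  im-ofℚ* x y = im-identity x (re y) (im y)
    where
    im-identity : ∀ x a b → x * b + 0ℚ * a ≡ x * b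
    im-identity = solve-∀ ℚ-acr

  im-∑ : ∀ n f → im (Σᵢ.∑ n f) ≡ Σℚ.∑ n (λ k → im (f k))
  im-∑ zero    f = refl
  im-∑ (suc n) f = cong (_+ im (f n)) (im-∑ n f)

module ℓ¹Norm where
  import Data.Nat.Properties as ℕ
  open import Data.Rational.Base using (ℚ; 0ℚ; 1ℚ; _+_; _*_; _-_; ∣_∣; _≤_)
  import Data.Rational.Properties as ℚ
  open import Defs using (natQ)
  open import Function.Base using (_∘_)
  open import Relation.Binary.PropositionalEquality
  open import Tactic.RingSolver using (solve-∀)
  open GaussianRationals
  open RationalArithmetic using (ℚ-acr; natQ-+; *-mono-≤-nonNeg)

  ‖_‖ : ℚ[i] → ℚ
  ‖ x ‖ = ∣ re x ∣ + ∣ im x ∣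

  ‖‖-nonNeg : ∀ x → 0ℚ ≤ ‖ x ‖
  ‖‖-nonNeg x = ℚ.+-mono-≤ (ℚ.0≤∣p∣ (re x)) (ℚ.0≤∣p∣ (im x))

  ∣im∣≤‖‖ : ∀ x → ∣ im x ∣ ≤ ‖ x ‖
  ∣im∣≤‖‖ x = begin
    ∣ im x ∣       ≡⟨ ℚ.+-identityˡ ∣ im x ∣ ⟨
    0ℚ + ∣ im x ∣  ≤⟨ ℚ.+-monoˡ-≤ ∣ im x ∣ (ℚ.0≤∣p∣ (re x)) ⟩
    ‖ x ‖          ∎
    where open ℚ.≤-Reasoning

  ‖x+y‖≤‖x‖+‖y‖ : ∀ x y → ‖ x +ᵢ y ‖ ≤ ‖ x ‖ + ‖ y ‖
  ‖x+y‖≤‖x‖+‖y‖ x y = begin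
    ∣ re x + re y ∣ + ∣ im x + im y ∣
      ≤⟨ ℚ.+-mono-≤ (ℚ.∣p+q∣≤∣p∣+∣q∣ (re x) (re y)) (ℚ.∣p+q∣≤∣p∣+∣q∣ (im x) (im y)) ⟩
    (∣ re x ∣ + ∣ re y ∣) + (∣ im x ∣ + ∣ im y ∣)
      ≡⟨ interchange (∣ re x ∣) (∣ re y ∣) (∣ im x ∣) (∣ im y ∣) ⟩
    ‖ x ‖ + ‖ y ‖ ∎
    where
    open ℚ.≤-Reasoning
    interchange : ∀ a b c d → (a + b) + (c + d) ≡ (a + c) + (b + d)
    interchange = solve-∀ ℚ-acr

  ‖x*y‖≤‖x‖*‖y‖ : ∀ x y → ‖ x *ᵢ y ‖ ≤ ‖ x ‖ * ‖ y ‖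
  ‖x*y‖≤‖x‖*‖y‖ (a +i b) (c +i d) = begin
    ∣ a * c - b * d ∣ + ∣ a * d + b * c ∣
      ≤⟨ ℚ.+-mono-≤ (ℚ.∣p-q∣≤∣p∣+∣q∣ (a * c) (b * d)) (ℚ.∣p+q∣≤∣p∣+∣q∣ (a * d) (b * c)) ⟩
    (∣ a * c ∣ + ∣ b * d ∣) + (∣ a * d ∣ + ∣ b * c ∣)
      ≡⟨ cong₂ _+_ (cong₂ _+_ (∣p*q∣ a c) (∣p*q∣ b d)) (cong₂ _+_ (∣p*q∣ a d) (∣p*q∣ b c)) ⟩
    (∣ a ∣ * ∣ c ∣ + ∣ b ∣ * ∣ d ∣) + (∣ a ∣ * ∣ d ∣ + ∣ b ∣ * ∣ c ∣)
      ≡⟨ expand (∣ a ∣) (∣ b ∣) (∣ c ∣) (∣ d ∣) ⟩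
    (∣ a ∣ + ∣ b ∣) * (∣ c ∣ + ∣ d ∣) ∎
    where
    open ℚ.≤-Reasoning
    ∣p*q∣ : ∀ p q → ∣ p * q ∣ ≡ ∣ p ∣ * ∣ q ∣
    ∣p*q∣ = ℚ.∣p*q∣≡∣p∣*∣q∣
    expand : ∀ a b c d → (a * c + b * d) + (a * d + b * c) ≡ (a + b) * (c + d)
    expand = solve-∀ ℚ-acr

  ‖∏‖≤1 : ∀ n {x : ℕ → ℚ[i]} → (∀ {m} → m ℕ.< n → ‖ x m ‖ ≤ 1ℚ) → ‖ Σᵢ.∏ n x ‖ ≤ 1ℚ
  ‖∏‖≤1 zero          ‖x‖≤1 = ℚ.≤-refl
  ‖∏‖≤1 (suc n) {x} ‖x‖≤1 = ℚ.≤-trans (‖x*y‖≤‖x‖*‖y‖ (Σᵢ.∏ n x) (x n))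
    (*-mono-≤-nonNeg (‖‖-nonNeg (Σᵢ.∏ n x)) (‖‖-nonNeg (x n))
      (‖∏‖≤1 n (‖x‖≤1 ∘ ℕ.m<n⇒m<1+n)) (‖x‖≤1 (ℕ.n<1+n n)))

  ‖∏-∏‖≤n*δ : ∀ n {x y : ℕ → ℚ[i]} {δ} →
              (∀ {m} → m ℕ.< n → ‖ x m ‖ ≤ 1ℚ) →
              (∀ {m} → m ℕ.< n → ‖ y m ‖ ≤ 1ℚ) →
              (∀ {m} → m ℕ.< n → ‖ x m -ᵢ y m ‖ ≤ δ) →
              ‖ Σᵢ.∏ n x -ᵢ Σᵢ.∏ n y ‖ ≤ natQ n * δ
  ‖∏-∏‖≤n*δ zero {δ = δ} _ _ _ = ℚ.≤-reflexive (sym (ℚ.*-zeroˡ δ))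
  ‖∏-∏‖≤n*δ (suc n) {x} {y} {δ} ‖x‖≤1 ‖y‖≤1 ‖x-y‖≤δ = begin
    ‖ X *ᵢ x n -ᵢ Y *ᵢ y n ‖
      ≡⟨ cong ‖_‖ (split X Y (x n) (y n)) ⟩
    ‖ (X -ᵢ Y) *ᵢ x n +ᵢ Y *ᵢ (x n -ᵢ y n) ‖
      ≤⟨ ‖x+y‖≤‖x‖+‖y‖ ((X -ᵢ Y) *ᵢ x n) (Y *ᵢ (x n -ᵢ y n)) ⟩
    ‖ (X -ᵢ Y) *ᵢ x n ‖ + ‖ Y *ᵢ (x n -ᵢ y n) ‖
      ≤⟨ ℚ.+-mono-≤ (‖x*y‖≤‖x‖*‖y‖ (X -ᵢ Y) (x n)) (‖x*y‖≤‖x‖*‖y‖ Y (x n -ᵢ y n)) ⟩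
    ‖ X -ᵢ Y ‖ * ‖ x n ‖ + ‖ Y ‖ * ‖ x n -ᵢ y n ‖
      ≤⟨ ℚ.+-mono-≤
           (*-mono-≤-nonNeg (‖‖-nonNeg (X -ᵢ Y)) (‖‖-nonNeg (x n))
             (‖∏-∏‖≤n*δ n (‖x‖≤1 ∘ below) (‖y‖≤1 ∘ below) (‖x-y‖≤δ ∘ below))
             (‖x‖≤1 (ℕ.n<1+n n)))
           (*-mono-≤-nonNeg (‖‖-nonNeg Y) (‖‖-nonNeg (x n -ᵢ y n))
             (‖∏‖≤1 n (‖y‖≤1 ∘ below)) (‖x-y‖≤δ (ℕ.n<1+n n))) ⟩
    natQ n * δ * 1ℚ + 1ℚ * δ
      ≡⟨ collect (natQ n) δ ⟩
    (1ℚ + natQ n) * δ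
      ≡⟨ cong (_* δ) (natQ-+ 1 n) ⟨
    natQ (suc n) * δ ∎
    where
    open ℚ.≤-Reasoning
    X Y : ℚ[i]
    X = Σᵢ.∏ n x
    Y = Σᵢ.∏ n y
    below : ∀ {m} → m ℕ.< n → m ℕ.< suc n
    below = ℕ.m<n⇒m<1+n
    split : ∀ X Y x y → X *ᵢ x -ᵢ Y *ᵢ y ≡ (X -ᵢ Y) *ᵢ x +ᵢ Y *ᵢ (x -ᵢ y)
    split = solve-∀ ℚ[i]-acr
    collect : ∀ n δ → n * δ * 1ℚ + 1ℚ * δ ≡ (1ℚ + n) * δ
    collect = solve-∀ ℚ-acr

module PochhammerRatios where
  open GaussianRationals
  open Σᵢ using (∑; ∏; ∑-cong; ∏-cong; ∑-*ˡ; ∑-+; ∑-neg; ∑-telescope; ∏-*; ∏-shift)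
  open import Relation.Binary.PropositionalEquality
  open import Tactic.RingSolver using (solve-∀)
  open ≡-Reasoning

  module Identity (z : ℚ[i]) (inv r : ℕ → ℚ[i])
                  (inv-inverse : ∀ m → (suc m × 1ᵢ -ᵢ z) *ᵢ inv m ≡ 1ᵢ)
                  (r-inverse   : ∀ k → suc k × 1ᵢ *ᵢ r k ≡ 1ᵢ)
                  where

    ratio : ℕ → ℕ → ℚ[i]
    ratio L n = ∏ n (λ m → (suc m × 1ᵢ -ᵢ L × 1ᵢ) *ᵢ inv m)

    -- Every use of a hypothesis u ≡ 1ᵢ below is isolated as a summand c *ᵢ (1ᵢ -ᵢ u),
    -- so that all remaining steps are plain ring identities.
    private
      absorb : ∀ {u} → u ≡ 1ᵢ → ∀ x c → x +ᵢ c *ᵢ (1ᵢ -ᵢ u) ≡ x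
      absorb refl = vanish
        where
        vanish : ∀ x c → x +ᵢ c *ᵢ (1ᵢ -ᵢ 1ᵢ) ≡ x
        vanish = solve-∀ ℚ[i]-acr

      numerator : ℕ → ℕ → ℚ[i]
      numerator L n = ∏ n (λ m → suc m × 1ᵢ -ᵢ L × 1ᵢ)

      ratio≡numerator*∏inv : ∀ L n → ratio L n ≡ numerator L n *ᵢ ∏ n inv
      ratio≡numerator*∏inv L n = ∏-* n (λ m → suc m × 1ᵢ -ᵢ L × 1ᵢ) inv

    ratio-telescope-step : ∀ L k →
      ratio L k -ᵢ ratio L (suc k) ≡ (L × 1ᵢ -ᵢ z) *ᵢ (ratio L k *ᵢ inv k)
    ratio-telescope-step L k = begin
      ρ -ᵢ ρ *ᵢ ((s -ᵢ l) *ᵢ inv k)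
        ≡⟨ expand ρ s l z (inv k) ⟩
      (l -ᵢ z) *ᵢ (ρ *ᵢ inv k) +ᵢ ρ *ᵢ (1ᵢ -ᵢ (s -ᵢ z) *ᵢ inv k)
        ≡⟨ absorb (inv-inverse k) ((l -ᵢ z) *ᵢ (ρ *ᵢ inv k)) ρ ⟩
      (l -ᵢ z) *ᵢ (ρ *ᵢ inv k) ∎
      where
      ρ l s : ℚ[i]
      ρ = ratio L k
      l = L × 1ᵢ
      s = suc k × 1ᵢ
      expand : ∀ ρ s l z i →
        ρ -ᵢ ρ *ᵢ ((s -ᵢ l) *ᵢ i) ≡ (l -ᵢ z) *ᵢ (ρ *ᵢ i) +ᵢ ρ *ᵢ (1ᵢ -ᵢ (s -ᵢ z) *ᵢ i)
      expand = solve-∀ ℚ[i]-acr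

    ratio-vanishes : ∀ M → ratio (suc M) (suc M) ≡ 0ᵢ
    ratio-vanishes M = vanish (ratio (suc M) M) (suc M × 1ᵢ) (inv M)
      where
      vanish : ∀ ρ l i → ρ *ᵢ ((l -ᵢ l) *ᵢ i) ≡ 0ᵢ
      vanish = solve-∀ ℚ[i]-acr

    ∑ratio*inv≡inv : ∀ M → ∑ (suc M) (λ k → ratio (suc M) k *ᵢ inv k) ≡ inv M
    ∑ratio*inv≡inv M = begin
      S
        ≡⟨ expand S (l -ᵢ z) (inv M) ⟩
      inv M *ᵢ ((l -ᵢ z) *ᵢ S) +ᵢ S *ᵢ (1ᵢ -ᵢ (l -ᵢ z) *ᵢ inv M)
        ≡⟨ absorb (inv-inverse M) (inv M *ᵢ ((l -ᵢ z) *ᵢ S)) S ⟩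
      inv M *ᵢ ((l -ᵢ z) *ᵢ S)
        ≡⟨ cong (inv M *ᵢ_) telescoped ⟩
      inv M *ᵢ 1ᵢ
        ≡⟨ *-identityʳ (inv M) ⟩
      inv M ∎
      where
      open CommutativeRing ℚ[i]-commutativeRing using (*-identityʳ)
      l S : ℚ[i]
      l = suc M × 1ᵢ
      S = ∑ (suc M) (λ k → ratio (suc M) k *ᵢ inv k)
      expand : ∀ S t i → S ≡ i *ᵢ (t *ᵢ S) +ᵢ S *ᵢ (1ᵢ -ᵢ t *ᵢ i)
      expand = solve-∀ ℚ[i]-acr
      telescoped : (l -ᵢ z) *ᵢ S ≡ 1ᵢ
      telescoped = begin
        (l -ᵢ z) *ᵢ S
          ≡⟨ ∑-*ˡ (suc M) (l -ᵢ z) (λ k → ratio (suc M) k *ᵢ inv k) ⟨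
        ∑ (suc M) (λ k → (l -ᵢ z) *ᵢ (ratio (suc M) k *ᵢ inv k))
          ≡⟨ ∑-cong (suc M) (λ {k} _ → ratio-telescope-step (suc M) k) ⟨
        ∑ (suc M) (λ k → ratio (suc M) k -ᵢ ratio (suc M) (suc k))
          ≡⟨ ∑-telescope (suc M) (ratio (suc M)) ⟩
        1ᵢ -ᵢ ratio (suc M) (suc M)
          ≡⟨ cong (λ x → 1ᵢ -ᵢ x) (ratio-vanishes M) ⟩
        1ᵢ -ᵢ 0ᵢ
          ≡⟨⟩
        1ᵢ ∎

    numerator-shift : ∀ L k → numerator (suc L) (suc k) ≡ -ᵢ (L × 1ᵢ) *ᵢ numerator L k
    numerator-shift L k = begin
      numerator (suc L) (suc k)
        ≡⟨ ∏-shift k (λ m → suc m × 1ᵢ -ᵢ suc L × 1ᵢ) ⟩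
      (1 × 1ᵢ -ᵢ suc L × 1ᵢ) *ᵢ ∏ k (λ m → suc (suc m) × 1ᵢ -ᵢ suc L × 1ᵢ)
        ≡⟨ cong₂ _*ᵢ_ (first (L × 1ᵢ)) (∏-cong k (λ {m} _ → shift (suc m × 1ᵢ) (L × 1ᵢ))) ⟩
      -ᵢ (L × 1ᵢ) *ᵢ numerator L k ∎
      where
      first : ∀ l → (1ᵢ +ᵢ 0ᵢ) -ᵢ (1ᵢ +ᵢ l) ≡ -ᵢ l
      first = solve-∀ ℚ[i]-acr
      shift : ∀ s l → (1ᵢ +ᵢ s) -ᵢ (1ᵢ +ᵢ l) ≡ s -ᵢ l
      shift = solve-∀ ℚ[i]-acr

    r*ratio-shift : ∀ L k →
      r k *ᵢ ratio (suc L) (suc k) ≡ r k *ᵢ ratio L (suc k) -ᵢ ratio L k *ᵢ inv k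
    r*ratio-shift L k = begin
      r k *ᵢ ratio (suc L) (suc k)
        ≡⟨ cong (r k *ᵢ_) (ratio≡numerator*∏inv (suc L) (suc k)) ⟩
      r k *ᵢ (numerator (suc L) (suc k) *ᵢ (P *ᵢ inv k))
        ≡⟨ cong (λ x → r k *ᵢ (x *ᵢ (P *ᵢ inv k))) (numerator-shift L k) ⟩
      r k *ᵢ (-ᵢ l *ᵢ c *ᵢ (P *ᵢ inv k))
        ≡⟨ expand (r k) l s c P (inv k) ⟩
      (r k *ᵢ (c *ᵢ (s -ᵢ l) *ᵢ (P *ᵢ inv k)) -ᵢ c *ᵢ P *ᵢ inv k)
        +ᵢ c *ᵢ P *ᵢ inv k *ᵢ (1ᵢ -ᵢ s *ᵢ r k)
        ≡⟨ absorb (r-inverse k) (r k *ᵢ (c *ᵢ (s -ᵢ l) *ᵢ (P *ᵢ inv k)) -ᵢ c *ᵢ P *ᵢ inv k)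
                                (c *ᵢ P *ᵢ inv k) ⟩
      r k *ᵢ (c *ᵢ (s -ᵢ l) *ᵢ (P *ᵢ inv k)) -ᵢ c *ᵢ P *ᵢ inv k
        ≡⟨ cong₂ (λ x y → r k *ᵢ x -ᵢ y *ᵢ inv k)
                 (ratio≡numerator*∏inv L (suc k)) (ratio≡numerator*∏inv L k) ⟨
      r k *ᵢ ratio L (suc k) -ᵢ ratio L k *ᵢ inv k ∎
      where
      l s c P : ℚ[i]
      l = L × 1ᵢ
      s = suc k × 1ᵢ
      c = numerator L k
      P = ∏ k inv
      expand : ∀ r l s c P i → r *ᵢ (-ᵢ l *ᵢ c *ᵢ (P *ᵢ i)) ≡
        (r *ᵢ (c *ᵢ (s -ᵢ l) *ᵢ (P *ᵢ i)) -ᵢ c *ᵢ P *ᵢ i) +ᵢ c *ᵢ P *ᵢ i *ᵢ (1ᵢ -ᵢ s *ᵢ r)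
      expand = solve-∀ ℚ[i]-acr

    ∑r*ratio≡-∑inv : ∀ M → ∑ M (λ k → r k *ᵢ ratio (suc M) (suc k)) ≡ -ᵢ ∑ M inv
    ∑r*ratio≡-∑inv zero    = refl
    ∑r*ratio≡-∑inv (suc M) = begin
      ∑ (suc M) (λ k → r k *ᵢ ratio (suc L) (suc k))
        ≡⟨ ∑-cong (suc M) (λ {k} _ → r*ratio-shift L k) ⟩
      ∑ (suc M) (λ k → r k *ᵢ ratio L (suc k) -ᵢ ratio L k *ᵢ inv k)
        ≡⟨ ∑-+ (suc M) (λ k → r k *ᵢ ratio L (suc k)) (λ k → -ᵢ (ratio L k *ᵢ inv k)) ⟩
      ∑ (suc M) (λ k → r k *ᵢ ratio L (suc k)) +ᵢ ∑ (suc M) (λ k → -ᵢ (ratio L k *ᵢ inv k))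
        ≡⟨ cong (∑ (suc M) (λ k → r k *ᵢ ratio L (suc k)) +ᵢ_)
                (∑-neg (suc M) (λ k → ratio L k *ᵢ inv k)) ⟩
      (∑ M (λ k → r k *ᵢ ratio L (suc k)) +ᵢ r M *ᵢ ratio L L) -ᵢ S
        ≡⟨ cong₂ (λ x y → (x +ᵢ r M *ᵢ y) -ᵢ S) (∑r*ratio≡-∑inv M) (ratio-vanishes M) ⟩
      (-ᵢ ∑ M inv +ᵢ r M *ᵢ 0ᵢ) -ᵢ S
        ≡⟨ cong (λ x → (-ᵢ ∑ M inv +ᵢ r M *ᵢ 0ᵢ) -ᵢ x) (∑ratio*inv≡inv M) ⟩
      (-ᵢ ∑ M inv +ᵢ r M *ᵢ 0ᵢ) -ᵢ inv M
        ≡⟨ collect (∑ M inv) (r M) (inv M) ⟩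
      -ᵢ ∑ (suc M) inv ∎
      where
      L : ℕ
      L = suc M
      S : ℚ[i]
      S = ∑ (suc M) (λ k → ratio L k *ᵢ inv k)
      collect : ∀ s r i → (-ᵢ s +ᵢ r *ᵢ 0ᵢ) -ᵢ i ≡ -ᵢ (s +ᵢ i)
      collect = solve-∀ ℚ[i]-acr

module StirlingSums where
  open import Data.Bool.Base using (true; false; if_then_else_; T)
  open import Data.List.Base using ([]; _∷_; length)
  import Data.Nat.Properties as ℕ
  open import Data.Rational.Base using (ℚ; 0ℚ; 1ℚ; _+_; _*_; -_; _-_)
  open import Defs using (Poly; coeff; rising; stirling1; sgn; natQ; sumQ)
  open import Relation.Binary.PropositionalEquality
  open import Tactic.RingSolver using (solve-∀)
  open GaussianRationals
  open PolynomialEvaluation ℚ[i]-commutativeRing using (eval; eval-shiftedRising)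
  open RationalArithmetic using (ℚ-acr; natQ-*; module Σℚ; sgn-+; sumQ≡∑)
  open ShiftedRising
  open ≡-Reasoning

  iN : ℕ → ℚ[i]
  iN N = 0ℚ +i natQ N

  imTerm : ℕ → Poly → ℕ → ℚ
  imTerm N p j = sgn j * natQ (coeff p (suc (2 ℕ.* j))) * natQ (N ℕ.^ suc (2 ℕ.* j))

  private
    2[1+j]≡2+2j : ∀ j → 2 ℕ.* suc j ≡ suc (suc (2 ℕ.* j))
    2[1+j]≡2+2j j = ℕ.*-suc 2 j

  ∑imTerm≡0 : ∀ N K p → length p ℕ.≤ 1 → Σℚ.∑ K (imTerm N p) ≡ 0ℚ
  ∑imTerm≡0 N K p len≤1 = Σℚ.∑-zero K (λ {j} _ → begin
    sgn j * natQ (coeff p (suc (2 ℕ.* j))) * x j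
      ≡⟨ cong (λ c → sgn j * natQ c * x j)
              (coeff-beyond-length p (ℕ.≤-trans len≤1 (ℕ.s≤s ℕ.z≤n))) ⟩
    sgn j * 0ℚ * x j
      ≡⟨ annihilate (sgn j) (x j) ⟩
    0ℚ ∎)
    where
    x : ℕ → ℚ
    x j = natQ (N ℕ.^ suc (2 ℕ.* j))
    annihilate : ∀ s x → s * 0ℚ * x ≡ 0ℚ
    annihilate = solve-∀ ℚ-acr

  imTerm-suc : ∀ N a b q j → imTerm N (a ∷ b ∷ q) (suc j) ≡ - (natQ N * natQ N) * imTerm N q j
  imTerm-suc N a b q j = begin
    imTerm N (a ∷ b ∷ q) (suc j)
      ≡⟨ cong (λ m → sgn (suc j) * natQ (coeff (a ∷ b ∷ q) (suc m)) * natQ (N ℕ.^ suc m))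
              (2[1+j]≡2+2j j) ⟩
    - sgn j * c * natQ (N ℕ.* (N ℕ.* N ℕ.^ suc (2 ℕ.* j)))
      ≡⟨ cong (λ x → - sgn j * c * x) (trans (natQ-* N _) (cong (natQ N *_) (natQ-* N _))) ⟩
    - sgn j * c * (natQ N * (natQ N * natQ (N ℕ.^ suc (2 ℕ.* j))))
      ≡⟨ regroup (sgn j) c (natQ N) (natQ (N ℕ.^ suc (2 ℕ.* j))) ⟩
    - (natQ N * natQ N) * imTerm N q j ∎
    where
    c : ℚ
    c = natQ (coeff q (suc (2 ℕ.* j)))
    regroup : ∀ s c n x → - s * c * (n * (n * x)) ≡ - (n * n) * (s * c * x)
    regroup = solve-∀ ℚ-acr

  im-eval-iN : ∀ N K p → length p ℕ.≤ suc (2 ℕ.* K) →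
               im (eval p (iN N)) ≡ Σℚ.∑ K (imTerm N p)
  im-eval-iN N K []       _ = sym (∑imTerm≡0 N K [] ℕ.z≤n)
  im-eval-iN N K (a ∷ []) _ = begin
    im (a × 1ᵢ) + (0ℚ * 0ℚ + natQ N * 0ℚ)
      ≡⟨ cong (λ x → im x + (0ℚ * 0ℚ + natQ N * 0ℚ)) (n×1ᵢ≡n+0i a) ⟩
    0ℚ + (0ℚ * 0ℚ + natQ N * 0ℚ)
      ≡⟨ vanish (natQ N) ⟩
    0ℚ
      ≡⟨ ∑imTerm≡0 N K (a ∷ []) ℕ.≤-refl ⟨
    Σℚ.∑ K (imTerm N (a ∷ [])) ∎
    where
    vanish : ∀ n → 0ℚ + (0ℚ * 0ℚ + n * 0ℚ) ≡ 0ℚ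
    vanish = solve-∀ ℚ-acr
  im-eval-iN N zero    (a ∷ b ∷ q) (ℕ.s≤s ())
  im-eval-iN N (suc K) (a ∷ b ∷ q) len≤ = begin
    im (a × 1ᵢ +ᵢ z *ᵢ (b × 1ᵢ +ᵢ z *ᵢ e))
      ≡⟨ cong₂ (λ x y → im (x +ᵢ z *ᵢ (y +ᵢ z *ᵢ e))) (n×1ᵢ≡n+0i a) (n×1ᵢ≡n+0i b) ⟩
    0ℚ + (0ℚ * (0ℚ + (0ℚ * im e + n * re e)) + n * (natQ b + (0ℚ * re e - n * im e)))
      ≡⟨ expand (natQ b) n (re e) (im e) ⟩
    n * natQ b + - (n * n) * im e
      ≡⟨ cong (λ y → n * natQ b + - (n * n) * y) (im-eval-iN N K q len≤q) ⟩
    n * natQ b + - (n * n) * Σℚ.∑ K (imTerm N q)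
      ≡⟨ cong₂ _+_ first (Σℚ.∑-*ˡ K (- (n * n)) (imTerm N q)) ⟨
    imTerm N (a ∷ b ∷ q) 0 + Σℚ.∑ K (λ j → - (n * n) * imTerm N q j)
      ≡⟨ cong (imTerm N (a ∷ b ∷ q) 0 +_) (Σℚ.∑-cong K (λ {j} _ → imTerm-suc N a b q j)) ⟨
    imTerm N (a ∷ b ∷ q) 0 + Σℚ.∑ K (λ j → imTerm N (a ∷ b ∷ q) (suc j))
      ≡⟨ Σℚ.∑-shift K (imTerm N (a ∷ b ∷ q)) ⟨
    Σℚ.∑ (suc K) (imTerm N (a ∷ b ∷ q)) ∎
    where
    z e : ℚ[i]
    z = iN N
    e = eval q z
    n : ℚ
    n = natQ N
    len≤q : length q ℕ.≤ suc (2 ℕ.* K)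
    len≤q = ℕ.≤-pred (ℕ.≤-pred (subst (λ m → length (a ∷ b ∷ q) ℕ.≤ suc m) (2[1+j]≡2+2j K) len≤))
    expand : ∀ b n x y → 0ℚ + (0ℚ * (0ℚ + (0ℚ * y + n * x)) + n * (b + (0ℚ * x - n * y))) ≡
                         n * b + - (n * n) * y
    expand = solve-∀ ℚ-acr
    first : imTerm N (a ∷ b ∷ q) 0 ≡ n * natQ b
    first = trans (cong (λ m → 1ℚ * natQ b * natQ m) (ℕ.*-identityʳ N)) (swap (natQ b) n)
      where
      swap : ∀ b n → 1ℚ * b * n ≡ n * b
      swap = solve-∀ ℚ-acr

  -- The summand of the definition of a, copied verbatim so that a n N unfolds to a sum of it.
  stirlingSummand : ℕ → ℕ → ℕ → ℚ
  stirlingSummand N n j =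
    if 2 ℕ.* j ℕ.<ᵇ n
    then sgn (n ℕ.+ j ℕ.+ 1) * natQ (stirling1 (n ℕ.+ 1) (2 ℕ.* j ℕ.+ 2)) * natQ (N ℕ.^ (2 ℕ.* j ℕ.+ 1))
    else 0ℚ

  stirlingSummand≡ : ∀ N n j → stirlingSummand N n j ≡ sgn (suc n) * imTerm N (shiftedRising n) j
  stirlingSummand≡ N n j with 2 ℕ.* j ℕ.<ᵇ n in 2j<ᵇn
  ... | true = begin
    sgn (n ℕ.+ j ℕ.+ 1) * natQ (coeff (rising (n ℕ.+ 1)) (2 ℕ.* j ℕ.+ 2)) * natQ (N ℕ.^ (2 ℕ.* j ℕ.+ 1))
      ≡⟨ cong₂ (λ s p → sgn s * natQ (coeff p (2 ℕ.* j ℕ.+ 2)) * natQ (N ℕ.^ (2 ℕ.* j ℕ.+ 1)))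
               (ℕ.+-comm (n ℕ.+ j) 1) (trans (cong rising (ℕ.+-comm n 1)) (rising-suc n)) ⟩
    sgn (suc n ℕ.+ j) * natQ (coeff (0 ∷ shiftedRising n) (2 ℕ.* j ℕ.+ 2)) * natQ (N ℕ.^ (2 ℕ.* j ℕ.+ 1))
      ≡⟨ cong₂ (λ k m → sgn (suc n ℕ.+ j) * natQ (coeff (0 ∷ shiftedRising n) k) * natQ (N ℕ.^ m))
               (ℕ.+-comm (2 ℕ.* j) 2) (ℕ.+-comm (2 ℕ.* j) 1) ⟩
    sgn (suc n ℕ.+ j) * c * x
      ≡⟨ cong (λ s → s * c * x) (sgn-+ (suc n) j) ⟩
    sgn (suc n) * sgn j * c * x
      ≡⟨ regroup (sgn (suc n)) (sgn j) c x ⟩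
    sgn (suc n) * imTerm N (shiftedRising n) j ∎
    where
    c x : ℚ
    c = natQ (coeff (shiftedRising n) (suc (2 ℕ.* j)))
    x = natQ (N ℕ.^ suc (2 ℕ.* j))
    regroup : ∀ s t c x → s * t * c * x ≡ s * (t * c * x)
    regroup = solve-∀ ℚ-acr
  ... | false = begin
    0ℚ
      ≡⟨ vanish (sgn (suc n)) (sgn j) x ⟨
    sgn (suc n) * (sgn j * 0ℚ * x)
      ≡⟨ cong (λ c → sgn (suc n) * (sgn j * natQ c * x)) (coeff-beyond-length (shiftedRising n) len≤) ⟨
    sgn (suc n) * imTerm N (shiftedRising n) j ∎
    where
    x : ℚ
    x = natQ (N ℕ.^ suc (2 ℕ.* j))
    vanish : ∀ s t x → s * (t * 0ℚ * x) ≡ 0ℚ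
    vanish = solve-∀ ℚ-acr
    len≤ : length (shiftedRising n) ℕ.≤ suc (2 ℕ.* j)
    len≤ = subst (ℕ._≤ suc (2 ℕ.* j)) (sym (length-shiftedRising n))
                 (ℕ.s≤s (ℕ.≮⇒≥ (λ 2j<n → subst T 2j<ᵇn (ℕ.<⇒<ᵇ 2j<n))))

  stirlingSum≡ : ∀ N n →
    sumQ n (stirlingSummand N n) ≡ sgn (suc n) * im (Σᵢ.∏ n (λ m → iN N +ᵢ suc m × 1ᵢ))
  stirlingSum≡ N n = begin
    sumQ n (stirlingSummand N n)
      ≡⟨ sumQ≡∑ n (stirlingSummand N n) ⟩
    Σℚ.∑ n (stirlingSummand N n)
      ≡⟨ Σℚ.∑-cong n (λ {j} _ → stirlingSummand≡ N n j) ⟩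
    Σℚ.∑ n (λ j → sgn (suc n) * imTerm N (shiftedRising n) j)
      ≡⟨ Σℚ.∑-*ˡ n (sgn (suc n)) (imTerm N (shiftedRising n)) ⟩
    sgn (suc n) * Σℚ.∑ n (imTerm N (shiftedRising n))
      ≡⟨ cong (sgn (suc n) *_) (im-eval-iN N n (shiftedRising n) len≤) ⟨
    sgn (suc n) * im (eval (shiftedRising n) (iN N))
      ≡⟨ cong (λ x → sgn (suc n) * im x) (eval-shiftedRising n (iN N)) ⟩
    sgn (suc n) * im (Σᵢ.∏ n (λ m → iN N +ᵢ suc m × 1ᵢ)) ∎
    where
    len≤ : length (shiftedRising n) ℕ.≤ suc (2 ℕ.* n)
    len≤ = subst (ℕ._≤ suc (2 ℕ.* n)) (sym (length-shiftedRising n)) (ℕ.s≤s (ℕ.m≤n*m n 2))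

module RatioAtIN (N : ℕ) where
  open import Data.Integer.Base as ℤ using (+_)
  open import Data.Rational.Base using (ℚ; 0ℚ; 1ℚ; _+_; _*_; -_; _-_; _/_)
  open import Defs using (natQ; sgn; a; prodQ; sumQ)
  open import Relation.Binary.PropositionalEquality
  open import Tactic.RingSolver using (solve-∀)
  open GaussianRationals
  open StirlingSums using (iN; stirlingSummand; stirlingSum≡)
  open RationalArithmetic
  open ≡-Reasoning

  d : ℕ → ℕ
  d m = suc m ℕ.* suc m ℕ.+ N ℕ.* N

  t : ℕ → ℚ
  t m = + 1 / d m

  inv : ℕ → ℚ[i]
  inv m = + suc m / d m +i + N / d m

  r : ℕ → ℚ[i]
  r k = ofℚ (+ 1 / suc k)

  q : ℕ → ℚ
  q m = (+ N ℤ.- + suc m) / d m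

  re-inv : ∀ m → re (inv m) ≡ natQ (suc m) * t m
  re-inv m = /≡fromℤ*1/ (+ suc m) (d m)

  im-inv : ∀ m → im (inv m) ≡ natQ N * t m
  im-inv m = /≡fromℤ*1/ (+ N) (d m)

  q≡ : ∀ m → q m ≡ (natQ N - natQ (suc m)) * t m
  q≡ m = trans (/≡fromℤ*1/ (+ N ℤ.- + suc m) (d m)) (cong (_* t m) (begin
    fromℤ (+ N ℤ.- + suc m)             ≡⟨ fromℤ-+ (+ N) (ℤ.- + suc m) ⟩
    natQ N + fromℤ (ℤ.- + suc m)        ≡⟨ cong (λ x → natQ N + x) (fromℤ-neg (+ suc m)) ⟩
    natQ N - natQ (suc m)               ∎))

  d*t≡1 : ∀ m → (natQ (suc m) * natQ (suc m) + natQ N * natQ N) * t m ≡ 1ℚ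
  d*t≡1 m = begin
    (natQ (suc m) * natQ (suc m) + natQ N * natQ N) * t m
      ≡⟨ cong (λ x → (x + natQ N * natQ N) * t m) (natQ-* (suc m) (suc m)) ⟨
    (natQ (suc m ℕ.* suc m) + natQ N * natQ N) * t m
      ≡⟨ cong (λ x → (natQ (suc m ℕ.* suc m) + x) * t m) (natQ-* N N) ⟨
    (natQ (suc m ℕ.* suc m) + natQ (N ℕ.* N)) * t m
      ≡⟨ cong (_* t m) (natQ-+ (suc m ℕ.* suc m) (N ℕ.* N)) ⟨
    natQ (d m) * t m
      ≡⟨ natQ*1/≡1 (d m) ⟩
    1ℚ ∎

  inv-inverse : ∀ m → (suc m × 1ᵢ -ᵢ iN N) *ᵢ inv m ≡ 1ᵢ
  inv-inverse m = trans (cong (λ x → (x -ᵢ iN N) *ᵢ inv m) (n×1ᵢ≡n+0i (suc m)))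
                        (ℚ[i]-ext re-part im-part)
    where
    k n : ℚ
    k = natQ (suc m)
    n = natQ N
    re-part : (k + - 0ℚ) * re (inv m) - (0ℚ + - n) * im (inv m) ≡ 1ℚ
    re-part = begin
      (k + - 0ℚ) * re (inv m) - (0ℚ + - n) * im (inv m)
        ≡⟨ cong₂ (λ x y → (k + - 0ℚ) * x - (0ℚ + - n) * y) (re-inv m) (im-inv m) ⟩
      (k + - 0ℚ) * (k * t m) - (0ℚ + - n) * (n * t m)
        ≡⟨ re-identity k n (t m) ⟩
      (k * k + n * n) * t m
        ≡⟨ d*t≡1 m ⟩
      1ℚ ∎
      where
      re-identity : ∀ k n t → (k + - 0ℚ) * (k * t) - (0ℚ + - n) * (n * t) ≡ (k * k + n * n) * t
      re-identity = solve-∀ ℚ-acr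
    im-part : (k + - 0ℚ) * im (inv m) + (0ℚ + - n) * re (inv m) ≡ 0ℚ
    im-part = begin
      (k + - 0ℚ) * im (inv m) + (0ℚ + - n) * re (inv m)
        ≡⟨ cong₂ (λ x y → (k + - 0ℚ) * y + (0ℚ + - n) * x) (re-inv m) (im-inv m) ⟩
      (k + - 0ℚ) * (n * t m) + (0ℚ + - n) * (k * t m)
        ≡⟨ im-identity k n (t m) ⟩
      0ℚ ∎
      where
      im-identity : ∀ k n t → (k + - 0ℚ) * (n * t) + (0ℚ + - n) * (k * t) ≡ 0ℚ
      im-identity = solve-∀ ℚ-acr

  r-inverse : ∀ k → suc k × 1ᵢ *ᵢ r k ≡ 1ᵢ
  r-inverse k = begin
    suc k × 1ᵢ *ᵢ r k                       ≡⟨ cong (_*ᵢ r k) (n×1ᵢ≡n+0i (suc k)) ⟩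
    ofℚ (natQ (suc k)) *ᵢ ofℚ (+ 1 / suc k) ≡⟨ ofℚ-* (natQ (suc k)) (+ 1 / suc k) ⟩
    ofℚ (natQ (suc k) * (+ 1 / suc k))      ≡⟨ cong ofℚ (natQ*1/≡1 (suc k)) ⟩
    1ᵢ                                      ∎

  open PochhammerRatios.Identity (iN N) inv r inv-inverse r-inverse public
    using (ratio; ∑r*ratio≡-∑inv)

  factor : ℕ → ℚ[i]
  factor m = (suc m × 1ᵢ -ᵢ N × 1ᵢ) *ᵢ inv m

  factor≡ : ∀ m → factor m ≡ - (q m * natQ (suc m)) +i - (q m * natQ N)
  factor≡ m = trans (cong₂ (λ x y → (x -ᵢ y) *ᵢ inv m) (n×1ᵢ≡n+0i (suc m)) (n×1ᵢ≡n+0i N))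
                    (ℚ[i]-ext re-part im-part)
    where
    k n : ℚ
    k = natQ (suc m)
    n = natQ N
    re-part : (k + - n) * re (inv m) - (0ℚ + - 0ℚ) * im (inv m) ≡ - (q m * k)
    re-part = begin
      (k + - n) * re (inv m) - (0ℚ + - 0ℚ) * im (inv m)
        ≡⟨ cong₂ (λ x y → (k + - n) * x - (0ℚ + - 0ℚ) * y) (re-inv m) (im-inv m) ⟩
      (k + - n) * (k * t m) - (0ℚ + - 0ℚ) * (n * t m)
        ≡⟨ re-identity k n (t m) ⟩
      - ((n - k) * t m * k)
        ≡⟨ cong (λ x → - (x * k)) (q≡ m) ⟨
      - (q m * k) ∎
      where
      re-identity : ∀ k n t → (k + - n) * (k * t) - (0ℚ + - 0ℚ) * (n * t) ≡ - ((n - k) * t * k)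
      re-identity = solve-∀ ℚ-acr
    im-part : (k + - n) * im (inv m) + (0ℚ + - 0ℚ) * re (inv m) ≡ - (q m * n)
    im-part = begin
      (k + - n) * im (inv m) + (0ℚ + - 0ℚ) * re (inv m)
        ≡⟨ cong₂ (λ x y → (k + - n) * y + (0ℚ + - 0ℚ) * x) (re-inv m) (im-inv m) ⟩
      (k + - n) * (n * t m) + (0ℚ + - 0ℚ) * (k * t m)
        ≡⟨ im-identity k n (t m) ⟩
      - ((n - k) * t m * n)
        ≡⟨ cong (λ x → - (x * n)) (q≡ m) ⟨
      - (q m * n) ∎
      where
      im-identity : ∀ k n t → (k + - n) * (n * t) + (0ℚ + - 0ℚ) * (k * t) ≡ - ((n - k) * t * n)
      im-identity = solve-∀ ℚ-acr

  factor≡ofℚ*[iN+1+m] : ∀ m → factor m ≡ ofℚ (- q m) *ᵢ (iN N +ᵢ suc m × 1ᵢ)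
  factor≡ofℚ*[iN+1+m] m = begin
    factor m
      ≡⟨ factor≡ m ⟩
    - (q m * k) +i - (q m * n)
      ≡⟨ ℚ[i]-ext (re-identity (q m) k n) (im-identity (q m) k n) ⟨
    ofℚ (- q m) *ᵢ (iN N +ᵢ (k +i 0ℚ))
      ≡⟨ cong (λ x → ofℚ (- q m) *ᵢ (iN N +ᵢ x)) (n×1ᵢ≡n+0i (suc m)) ⟨
    ofℚ (- q m) *ᵢ (iN N +ᵢ suc m × 1ᵢ) ∎
    where
    k n : ℚ
    k = natQ (suc m)
    n = natQ N
    re-identity : ∀ q k n → - q * (0ℚ + k) - 0ℚ * (n + 0ℚ) ≡ - (q * k)
    re-identity = solve-∀ ℚ-acr
    im-identity : ∀ q k n → - q * (n + 0ℚ) + 0ℚ * (0ℚ + k) ≡ - (q * n)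
    im-identity = solve-∀ ℚ-acr

  ratio≡ofℚ*∏ : ∀ n → ratio N n ≡ ofℚ (Σℚ.∏ n (λ m → - q m)) *ᵢ Σᵢ.∏ n (λ m → iN N +ᵢ suc m × 1ᵢ)
  ratio≡ofℚ*∏ n = begin
    ratio N n
      ≡⟨ Σᵢ.∏-cong n (λ {m} _ → factor≡ofℚ*[iN+1+m] m) ⟩
    Σᵢ.∏ n (λ m → ofℚ (- q m) *ᵢ (iN N +ᵢ suc m × 1ᵢ))
      ≡⟨ Σᵢ.∏-* n (λ m → ofℚ (- q m)) (λ m → iN N +ᵢ suc m × 1ᵢ) ⟩
    Σᵢ.∏ n (λ m → ofℚ (- q m)) *ᵢ G
      ≡⟨ cong (_*ᵢ G) (∏-ofℚ n (λ m → - q m)) ⟩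
    ofℚ (Σℚ.∏ n (λ m → - q m)) *ᵢ G ∎
    where
    G : ℚ[i]
    G = Σᵢ.∏ n (λ m → iN N +ᵢ suc m × 1ᵢ)

  a≡-im-ratio : ∀ n → a n N ≡ - im (ratio N n)
  a≡-im-ratio n = begin
    prodQ n q * sumQ n (stirlingSummand N n)
      ≡⟨ cong₂ _*_ (prodQ≡∏ n q) (stirlingSum≡ N n) ⟩
    Σℚ.∏ n q * (sgn (suc n) * im G)
      ≡⟨ regroup (sgn n) (Σℚ.∏ n q) (im G) ⟩
    - (sgn n * Σℚ.∏ n q * im G)
      ≡⟨ cong (λ x → - (x * im G)) (∏-neg n q) ⟨
    - (Σℚ.∏ n (λ m → - q m) * im G)
      ≡⟨ cong -_ (im-ofℚ* (Σℚ.∏ n (λ m → - q m)) G) ⟨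
    - im (ofℚ (Σℚ.∏ n (λ m → - q m)) *ᵢ G)
      ≡⟨ cong (λ x → - im x) (ratio≡ofℚ*∏ n) ⟨
    - im (ratio N n) ∎
    where
    G : ℚ[i]
    G = Σᵢ.∏ n (λ m → iN N +ᵢ suc m × 1ᵢ)
    regroup : ∀ s p g → p * (- s * g) ≡ - (s * p * g)
    regroup = solve-∀ ℚ-acr

module SumIdentity where
  open import Data.Integer.Base using (+_)
  open import Data.Rational.Base using (_*_; -_; _/_)
  open import Defs using (a; sumQ)
  open import Relation.Binary.PropositionalEquality
  open import Tactic.RingSolver using (solve-∀)
  open GaussianRationals
  open RationalArithmetic using (ℚ-acr; module Σℚ; sumQ≡∑)
  open ≡-Reasoning

  sum-identity : (N : ℕ) → 1 ℕ.≤ N →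
    sumQ (N ℕ.∸ 1) (λ k → a (suc k) N * (+ 1 / suc k)) ≡
    sumQ (N ℕ.∸ 1) (λ k → + N / (suc k ℕ.* suc k ℕ.+ N ℕ.* N))
  sum-identity N@(suc M) _ = begin
    sumQ M (λ k → a (suc k) N * (+ 1 / suc k))
      ≡⟨ sumQ≡∑ M (λ k → a (suc k) N * (+ 1 / suc k)) ⟩
    Σℚ.∑ M (λ k → a (suc k) N * (+ 1 / suc k))
      ≡⟨ Σℚ.∑-cong M (λ {k} _ → summand≡ k) ⟩
    Σℚ.∑ M (λ k → im (-ᵢ (r k *ᵢ ratio N (suc k))))
      ≡⟨ im-∑ M (λ k → -ᵢ (r k *ᵢ ratio N (suc k))) ⟨
    im (Σᵢ.∑ M (λ k → -ᵢ (r k *ᵢ ratio N (suc k))))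
      ≡⟨ cong im (Σᵢ.∑-neg M (λ k → r k *ᵢ ratio N (suc k))) ⟩
    im (-ᵢ Σᵢ.∑ M (λ k → r k *ᵢ ratio N (suc k)))
      ≡⟨ cong (λ x → im (-ᵢ x)) (∑r*ratio≡-∑inv M) ⟩
    - - im (Σᵢ.∑ M inv)
      ≡⟨ double-negation (im (Σᵢ.∑ M inv)) ⟩
    im (Σᵢ.∑ M inv)
      ≡⟨ im-∑ M inv ⟩
    Σℚ.∑ M (λ k → im (inv k))
      ≡⟨ sumQ≡∑ M (λ k → im (inv k)) ⟨
    sumQ M (λ k → im (inv k)) ∎
    where
    open RatioAtIN N using (inv; r; ratio; ∑r*ratio≡-∑inv; a≡-im-ratio)
    double-negation : ∀ x → - - x ≡ x
    double-negation = solve-∀ ℚ-acr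
    summand≡ : ∀ k → a (suc k) N * (+ 1 / suc k) ≡ im (-ᵢ (r k *ᵢ ratio N (suc k)))
    summand≡ k = begin
      a (suc k) N * (+ 1 / suc k)              ≡⟨ cong (_* (+ 1 / suc k)) (a≡-im-ratio (suc k)) ⟩
      - im (ratio N (suc k)) * (+ 1 / suc k)   ≡⟨ swap (im (ratio N (suc k))) (+ 1 / suc k) ⟩
      - (+ 1 / suc k * im (ratio N (suc k)))   ≡⟨ cong -_ (im-ofℚ* (+ 1 / suc k) (ratio N (suc k))) ⟨
      im (-ᵢ (r k *ᵢ ratio N (suc k)))         ∎
      where
      swap : ∀ x y → - x * y ≡ - (y * x)
      swap = solve-∀ ℚ-acr

module FactorBounds (N m : ℕ) (1+m≤N : suc m ℕ.≤ N) where
  open import Data.Integer.Base using (+_)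
  import Data.Nat.Properties as ℕ
  open import Data.Nat.Tactic.RingSolver using () renaming (solve-∀ to ℕ-solve-∀)
  open import Data.Rational.Base using (0ℚ; 1ℚ; _+_; _*_; -_; _-_; _/_; _≤_; ∣_∣)
  import Data.Rational.Properties as ℚ
  open import Defs using (natQ)
  open import Relation.Binary.PropositionalEquality
  open import Tactic.RingSolver using (solve-∀)
  open GaussianRationals
  open ℓ¹Norm
  open RationalArithmetic
  open RatioAtIN N using (d; t; q; q≡; d*t≡1; factor; factor≡)

  private
    k D : ℕ
    k = suc m
    D = N ℕ.∸ k

    D+k≡N : D ℕ.+ k ≡ N
    D+k≡N = ℕ.m∸n+n≡m 1+m≤N

    natQ-N : natQ N ≡ natQ D + natQ k
    natQ-N = trans (cong natQ (sym D+k≡N)) (natQ-+ D k)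

    natQ*t≡/ : ∀ x → natQ x * t m ≡ + x / d m
    natQ*t≡/ x = sym (/≡fromℤ*1/ (+ x) (d m))

    -q*natQ≡ : ∀ x → - (q m * natQ x) ≡ - (+ (D ℕ.* x) / d m)
    -q*natQ≡ x = cong -_ (begin
      q m * natQ x                               ≡⟨ cong (_* natQ x) (q≡ m) ⟩
      (natQ N - natQ k) * t m * natQ x           ≡⟨ cong (λ n → (n - natQ k) * t m * natQ x) natQ-N ⟩
      (natQ D + natQ k - natQ k) * t m * natQ x  ≡⟨ cancel (natQ D) (natQ k) (t m) (natQ x) ⟩
      natQ D * natQ x * t m                      ≡⟨ cong (_* t m) (natQ-* D x) ⟨
      natQ (D ℕ.* x) * t m                       ≡⟨ natQ*t≡/ (D ℕ.* x) ⟩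
      + (D ℕ.* x) / d m                          ∎)
      where
      open ≡-Reasoning
      cancel : ∀ D k t x → (D + k - k) * t * x ≡ D * x * t
      cancel = solve-∀ ℚ-acr

  ‖factor‖≤1 : ‖ factor m ‖ ≤ 1ℚ
  ‖factor‖≤1 = begin
    ∣ re (factor m) ∣ + ∣ im (factor m) ∣
      ≡⟨ cong₂ (λ x y → ∣ x ∣ + ∣ y ∣) (trans (cong re (factor≡ m)) (-q*natQ≡ k))
                                        (trans (cong im (factor≡ m)) (-q*natQ≡ N)) ⟩
    ∣ - (+ (D ℕ.* k) / d m) ∣ + ∣ - (+ (D ℕ.* N) / d m) ∣
      ≡⟨ cong₂ _+_ (∣-+/∣≡ (D ℕ.* k) (d m)) (∣-+/∣≡ (D ℕ.* N) (d m)) ⟩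
    + (D ℕ.* k) / d m + + (D ℕ.* N) / d m
      ≡⟨ +/+≡ (D ℕ.* k) (D ℕ.* N) (d m) ⟩
    + (D ℕ.* k ℕ.+ D ℕ.* N) / d m
      ≤⟨ /≤/ (D ℕ.* k ℕ.+ D ℕ.* N) 1 (d m) 1 numerator≤d ⟩
    1ℚ ∎
    where
    open ℚ.≤-Reasoning
    expand : ∀ D k → 1 ℕ.* (k ℕ.* k ℕ.+ (D ℕ.+ k) ℕ.* (D ℕ.+ k)) ≡
                     (D ℕ.* k ℕ.+ D ℕ.* (D ℕ.+ k)) ℕ.* 1 ℕ.+ 2 ℕ.* k ℕ.* k
    expand = ℕ-solve-∀
    numerator≤d : (D ℕ.* k ℕ.+ D ℕ.* N) ℕ.* 1 ℕ.≤ 1 ℕ.* d m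
    numerator≤d = subst (λ N → (D ℕ.* k ℕ.+ D ℕ.* N) ℕ.* 1 ℕ.≤ 1 ℕ.* (k ℕ.* k ℕ.+ N ℕ.* N)) D+k≡N
      (subst ((D ℕ.* k ℕ.+ D ℕ.* (D ℕ.+ k)) ℕ.* 1 ℕ.≤_) (sym (expand D k)) (ℕ.m≤m+n _ _))

  ‖factor+i‖≤2k/N : .{{_ : ℕ.NonZero N}} → ‖ factor m -ᵢ -i ‖ ≤ + (2 ℕ.* k) / N
  ‖factor+i‖≤2k/N = begin
    ∣ re (factor m) + - 0ℚ ∣ + ∣ im (factor m) + - - 1ℚ ∣
      ≡⟨ cong₂ (λ x y → ∣ x ∣ + ∣ y ∣) re-part im-part ⟩
    ∣ - (+ (D ℕ.* k) / d m) ∣ + ∣ + (k ℕ.* (k ℕ.+ N)) / d m ∣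
      ≡⟨ cong₂ _+_ (∣-+/∣≡ (D ℕ.* k) (d m)) (∣+/∣≡ (k ℕ.* (k ℕ.+ N)) (d m)) ⟩
    + (D ℕ.* k) / d m + + (k ℕ.* (k ℕ.+ N)) / d m
      ≡⟨ +/+≡ (D ℕ.* k) (k ℕ.* (k ℕ.+ N)) (d m) ⟩
    + (D ℕ.* k ℕ.+ k ℕ.* (k ℕ.+ N)) / d m
      ≤⟨ /≤/ (D ℕ.* k ℕ.+ k ℕ.* (k ℕ.+ N)) (2 ℕ.* k) (d m) N cross-multiplied ⟩
    + (2 ℕ.* k) / N ∎
    where
    open ℚ.≤-Reasoning
    re-part : re (factor m) + - 0ℚ ≡ - (+ (D ℕ.* k) / d m)
    re-part = trans (ℚ.+-identityʳ (re (factor m))) (trans (cong re (factor≡ m)) (-q*natQ≡ k))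
    im-part : im (factor m) + - - 1ℚ ≡ + (k ℕ.* (k ℕ.+ N)) / d m
    im-part = begin-equality
      im (factor m) + - - 1ℚ
        ≡⟨ cong (λ x → im x + - - 1ℚ) (factor≡ m) ⟩
      - (q m * natQ N) + - - 1ℚ
        ≡⟨ cong₂ (λ x y → - (x * natQ N) + - - y) (q≡ m) (sym (d*t≡1 m)) ⟩
      - ((natQ N - natQ k) * t m * natQ N) + - - ((natQ k * natQ k + natQ N * natQ N) * t m)
        ≡⟨ cong (λ n → - ((n - natQ k) * t m * n) + - - ((natQ k * natQ k + n * n) * t m)) natQ-N ⟩
      - ((natQ D + natQ k - natQ k) * t m * (natQ D + natQ k))
        + - - ((natQ k * natQ k + (natQ D + natQ k) * (natQ D + natQ k)) * t m)
        ≡⟨ simplify (natQ D) (natQ k) (t m) ⟩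
      natQ k * (natQ k + (natQ D + natQ k)) * t m
        ≡⟨ cong (λ n → natQ k * (natQ k + n) * t m) natQ-N ⟨
      natQ k * (natQ k + natQ N) * t m
        ≡⟨ cong (_* t m) (trans (natQ-* k (k ℕ.+ N)) (cong (natQ k *_) (natQ-+ k N))) ⟨
      natQ (k ℕ.* (k ℕ.+ N)) * t m
        ≡⟨ natQ*t≡/ (k ℕ.* (k ℕ.+ N)) ⟩
      + (k ℕ.* (k ℕ.+ N)) / d m ∎
      where
      simplify : ∀ D k t →
        - ((D + k - k) * t * (D + k)) + - - ((k * k + (D + k) * (D + k)) * t) ≡ k * (k + (D + k)) * t
      simplify = solve-∀ ℚ-acr
    expand : ∀ D k → (2 ℕ.* k) ℕ.* (k ℕ.* k ℕ.+ (D ℕ.+ k) ℕ.* (D ℕ.+ k)) ≡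
                     (D ℕ.* k ℕ.+ k ℕ.* (k ℕ.+ (D ℕ.+ k))) ℕ.* (D ℕ.+ k) ℕ.+ 2 ℕ.* k ℕ.* k ℕ.* k
    expand = ℕ-solve-∀
    cross-multiplied : (D ℕ.* k ℕ.+ k ℕ.* (k ℕ.+ N)) ℕ.* N ℕ.≤ (2 ℕ.* k) ℕ.* d m
    cross-multiplied =
      subst (λ N → (D ℕ.* k ℕ.+ k ℕ.* (k ℕ.+ N)) ℕ.* N ℕ.≤ (2 ℕ.* k) ℕ.* (k ℕ.* k ℕ.+ N ℕ.* N)) D+k≡N
        (subst ((D ℕ.* k ℕ.+ k ℕ.* (k ℕ.+ (D ℕ.+ k))) ℕ.* (D ℕ.+ k) ℕ.≤_) (sym (expand D k))
               (ℕ.m≤m+n _ _))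

module Limit where
  open import Data.Bool.Base using (true; false)
  open import Data.Integer.Base using (+_)
  open import Data.Nat.DivMod using (_%_; m/n≡1+[m∸n]/n)
  import Data.Nat.Properties as ℕ
  open import Data.Product.Base using (_,_; ∃-syntax)
  open import Data.Rational.Base using (ℚ; 0ℚ; 1ℚ; _+_; _*_; -_; _-_; _/_; _≤_; _<_; ∣_∣)
  import Data.Rational.Properties as ℚ
  open import Defs using (natQ; sgn; a; limitValue)
  open import Relation.Binary.PropositionalEquality
  open import Tactic.RingSolver using (solve-∀)
  open GaussianRationals
  open ℓ¹Norm
  open RationalArithmetic

  private
    limitValue-+2 : ∀ n → limitValue (suc (suc n)) ≡ - limitValue n
    limitValue-+2 zero    = refl
    limitValue-+2 (suc n) with suc n % 2 ℕ.≡ᵇ 0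
    ... | true  = refl
    ... | false = cong sgn (m/n≡1+[m∸n]/n {suc (suc n)} {2} (ℕ.s≤s (ℕ.s≤s ℕ.z≤n)))

  limitValue≡-im[-i]ⁿ : ∀ n → limitValue n ≡ - im (Σᵢ.∏ n (λ _ → -i))
  limitValue≡-im[-i]ⁿ zero          = refl
  limitValue≡-im[-i]ⁿ (suc zero)    = refl
  limitValue≡-im[-i]ⁿ (suc (suc n)) = begin
    limitValue (suc (suc n))              ≡⟨ limitValue-+2 n ⟩
    - limitValue n                        ≡⟨ cong -_ (limitValue≡-im[-i]ⁿ n) ⟩
    - - im U                              ≡⟨ cong -_ (im-*[-i]² (re U) (im U)) ⟨
    - im (Σᵢ.∏ (suc (suc n)) (λ _ → -i))  ∎
    where
    open ≡-Reasoning
    U : ℚ[i]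
    U = Σᵢ.∏ n (λ _ → -i)
    im-*[-i]² : ∀ x y → (x * 0ℚ - y * - 1ℚ) * - 1ℚ + (x * - 1ℚ + y * 0ℚ) * 0ℚ ≡ - y
    im-*[-i]² = solve-∀ ℚ-acr

  ∣a-limitValue∣≤ : ∀ n N .{{_ : ℕ.NonZero N}} → n ℕ.≤ N →
                    ∣ a n N - limitValue n ∣ ≤ + (n ℕ.* (2 ℕ.* n)) / N
  ∣a-limitValue∣≤ n N n≤N = begin
    ∣ a n N - limitValue n ∣
      ≡⟨ cong₂ (λ x y → ∣ x - y ∣) (a≡-im-ratio n) (limitValue≡-im[-i]ⁿ n) ⟩
    ∣ - im B - - im U ∣
      ≡⟨ cong ∣_∣ (neg-distrib (im B) (im U)) ⟩
    ∣ - im (B -ᵢ U) ∣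
      ≡⟨ ℚ.∣-p∣≡∣p∣ (im (B -ᵢ U)) ⟩
    ∣ im (B -ᵢ U) ∣
      ≤⟨ ∣im∣≤‖‖ (B -ᵢ U) ⟩
    ‖ B -ᵢ U ‖
      ≤⟨ ‖∏-∏‖≤n*δ n ‖factor‖≤1 (λ _ → ℚ.≤-refl) ‖factor+i‖≤2n/N ⟩
    natQ n * (+ (2 ℕ.* n) / N)
      ≡⟨ natQ*+/≡ n (2 ℕ.* n) N ⟩
    + (n ℕ.* (2 ℕ.* n)) / N ∎
    where
    open ℚ.≤-Reasoning
    open RatioAtIN N using (a≡-im-ratio; ratio; factor)
    B U : ℚ[i]
    B = ratio N n
    U = Σᵢ.∏ n (λ _ → -i)
    neg-distrib : ∀ x y → - x - - y ≡ - (x - y)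
    neg-distrib = solve-∀ ℚ-acr
    ‖factor‖≤1 : ∀ {m} → m ℕ.< n → ‖ factor m ‖ ≤ 1ℚ
    ‖factor‖≤1 {m} m<n = FactorBounds.‖factor‖≤1 N m (ℕ.≤-trans m<n n≤N)
    ‖factor+i‖≤2n/N : ∀ {m} → m ℕ.< n → ‖ factor m -ᵢ -i ‖ ≤ + (2 ℕ.* n) / N
    ‖factor+i‖≤2n/N {m} m<n = ℚ.≤-trans (FactorBounds.‖factor+i‖≤2k/N N m (ℕ.≤-trans m<n n≤N))
      (/≤/ (2 ℕ.* suc m) (2 ℕ.* n) N N (ℕ.*-monoˡ-≤ N (ℕ.*-monoʳ-≤ 2 m<n)))

  a⟶limitValue : (n : ℕ) → 1 ℕ.≤ n → (ε : ℚ) → 0ℚ < ε →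
                 ∃[ M ] ((N : ℕ) → M ℕ.≤ N → ∣ a n N - limitValue n ∣ < ε)
  a⟶limitValue n 1≤n ε 0<ε with +c/N<ε (n ℕ.* (2 ℕ.* n)) 0<ε
  ... | M , c/N<ε = M ℕ.⊔ n , eventually
    where
    eventually : (N : ℕ) → M ℕ.⊔ n ℕ.≤ N → ∣ a n N - limitValue n ∣ < ε
    eventually N M⊔n≤N =
      ℚ.≤-<-trans (∣a-limitValue∣≤ n N {{N≢0}} n≤N) (c/N<ε N {{N≢0}} (ℕ.≤-trans (ℕ.m≤m⊔n M n) M⊔n≤N))
      where
      n≤N : n ℕ.≤ N
      n≤N = ℕ.≤-trans (ℕ.m≤n⊔m M n) M⊔n≤N
      N≢0 : ℕ.NonZero N
      N≢0 = ℕ.>-nonZero (ℕ.≤-trans 1≤n n≤N)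

open import Defs
open import Data.Nat using (ℕ; suc; _≤_; _*_; _∸_)
open import Data.Integer using (+_)
open import Data.Rational using (ℚ; 0ℚ; _<_; ∣_∣; _-_)
import Data.Rational as ℚ
open import Data.Product using (_×_; ∃-syntax; _,_)
open import Relation.Binary.PropositionalEquality using (_≡_)

mainTheorem3 :
    ((N : ℕ) → 1 ≤ N →
      sumQ (N ∸ 1) (λ k → a (suc k) N ℚ.* ((+ 1) ℚ./ suc k))
        ≡ sumQ (N ∸ 1) (λ k → (+ N) ℚ./ (suc k * suc k ℕ.+ N * N)))
    × ((n : ℕ) → 1 ≤ n → (ε : ℚ) → 0ℚ < ε →
        ∃[ M ] ((N : ℕ) → M ≤ N → ∣ a n N - limitValue n ∣ < ε))
mainTheorem3 = SumIdentity.sum-identity , Limit.a⟶limitValue
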